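{- For well-formed networks of the calculus CaIT the following hold. (1) $n[\mathcal I\bowtie a!v.P\parallel R]^\mu_h\gtrsim n[\mathcal I\bowtie P\parallel R]^\mu_h$ if $\mathcal I(a)=v$ and $a$ does not occur in $R$. (2) $n[\mathcal I\bowtie @(x).P\parallel R]^\mu_h\gtrsim n[\mathcal I\bowtie P\{h/x\}\parallel R]^\mu_h$. (3) $n[\mathcal I\bowtie \lfloor\overline c\langle v\rangle.P\rfloor S\parallel\lfloor c(x).Q\rfloor T\parallel R]^\mu_h\gtrsim n[\mathcal I\bowtie P\parallel Q\{v/x\}\parallel R]^\mu_h$ if $c$ does not occur in $R$ and $\mathrm{rng}(c)=-1$. (4) $(\nu c)\big(n[\mathcal I\bowtie\lfloor\overline c\langle v\rangle.P\rfloor S\parallel R]^\mu_h\mid m[\mathcal J\bowtie\lfloor c(x).Q\rfloor T\parallel U]^{\mu'}_k\big)\gtrsim(\nu c)\big(n[\mathcal I\bowtie P\parallel R]^\mu_h\mid m[\mathcal J\bowtie Q\{v/x\}\parallel U]^{\mu'}_k\big)$ if $\mathrm{rng}(c)=\infty$ and $c$ occurs neither in $R$ nor in $U$. (5) $n[\mathcal I\bowtie P]^\mu_h\approx n[\mathcal I\bowtie\mathsf{nil}]^\mu_h$ if no subterm of the form $\lfloor\pi.P_1\rfloor P_2$ or $a!v.P_1$ occurs in $P$. (6) $n[\mathcal I\bowtie\mathsf{nil}]^\mu_h\approx\mathbf 0$ if $\mathcal I(a)$ is undefined for every actuator $a$. (7) $n[\emptyset\bowtie P]^{\mathsf m}_h\approx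 m[\emptyset\bowtie P]^{\mathsf s}_k$ if $P$ contains no subterm of the form $@(x).Q$ and every channel $c$ occurring in $P$ has $\mathrm{rng}(c)=\infty$ or $\mathrm{rng}(c)=-1$.
   Context: The calculus CaIT. Fix a set of locations with a distance $d(h,k)\in\mathbb N$ between locations, a constant $\delta\in\mathbb N$, and a function $\mathrm{rng}$ giving each channel $c$ a range $\mathrm{rng}(c)\in\mathbb N\cup\{ -1,\infty\}$. Values $v,w$ include basic values, sensor/actuator values and locations; boolean guards $b$ are decidable. Processes: $P,Q::=\mathsf{nil}\mid \rho.P\mid P\parallel Q\mid \lfloor\pi.P\rfloor Q\mid [b]P;Q\mid X\mid \mathsf{fix}\,X.P$ with $\rho\in\{\sigma,\ @(x),\ s?(x),\ a!v\}$ ($s$ a sensor, $a$ an actuator) and $\pi\in\{\overline{c}\langle v\rangle,\ c(x)\}$. The variable $x$ is bound in $c(x).P$, $s?(x).P$, $@(x).P$ and $X$ in $\mathsf{fix}X.P$; in $\sigma.Q$ and $\lfloor\pi.P\rfloor Q$ the occurrence of $Q$ is time-guarded, and in $\mathsf{fix}X.P$ all occurrences of $X$ must be time-guarded. Networks: $M,N::=\mathbf 0\mid n[\mathcal I\bowtie P]^{\mu}_{h}\mid M\mid N\mid (\nu c)M$, where $n$ is a node name, $\mathcal I$ a partial map from sensor and actuator names to values (physical interface), $\mu\in\{\mathsf s,\mathsf m\}$ (stationary/mobile) and $h$ a location. Sensors are node-dependent or location-dependent. Networks are closed and well-formed: node names are distinct; distinct nodes have distinct actuators and distinct node-dependent sensors;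 if $P$ in $n[\mathcal I\bowtie P]^\mu_h$ contains $s?(x)$ (resp. $a!v$) then $\mathcal I(s)$ (resp. $\mathcal I(a)$) is defined; a node whose interface defines a location-dependent sensor is stationary. $T\{v/x\}$ is substitution. Structural congruence $\equiv$ is the least congruence with: $\parallel$ commutative, associative, unit $\mathsf{nil}$; $[b]P;Q\equiv P$ if $b$ true, $\equiv Q$ if $b$ false; $\mathsf{fix}X.P\equiv P\{\mathsf{fix}X.P/X\}$; $P\equiv Q$ implies $n[\mathcal I\bowtie P]^\mu_h\equiv n[\mathcal I\bowtie Q]^\mu_h$; network $\mid$ commutative, associative, unit $\mathbf 0$; $(\nu c)\mathbf 0\equiv\mathbf 0$; $(\nu c)(\nu d)M\equiv(\nu d)(\nu c)M$; $(\nu c)(M\mid N)\equiv M\mid(\nu c)N$ if $c$ not in $M$. Labelled (intensional) semantics. Process transitions $P\xrightarrow{\lambda}P'$, $\lambda\in\{\sigma,\tau,\overline cv,cv,@h,s?v,a!v\}$, with $[b]P;Q$ identified with $P$ if $b$ is true and with $Q$ otherwise, are the least relation closed under: $\lfloor\overline c\langle v\rangle.P\rfloor Q\xrightarrow{\overline cv}P$; $\lfloor c(x).P\rfloor Q\xrightarrow{cv}P\{v/x\}$ (any $v$); $s?(x).P\xrightarrow{s?v}P\{v/x\}$ (any $v$); $a!v.P\xrightarrow{a!v}P$; $@(x).P\xrightarrow{@h}P\{h/x\}$ (any $h$); if $P\xrightarrow{\overline cv}P'$, $Q\xrightarrow{cv}Q'$ and $\mathrm{rng}(c)=-1$ then $P\parallel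 Q\xrightarrow{\tau}P'\parallel Q'$ and $Q\parallel P\xrightarrow{\tau}Q'\parallel P'$; if $P\xrightarrow{\lambda}P'$ with $\lambda\ne\sigma$ then $P\parallel Q\xrightarrow{\lambda}P'\parallel Q$ and $Q\parallel P\xrightarrow{\lambda}Q\parallel P'$; if $P\{\mathsf{fix}X.P/X\}\xrightarrow{\lambda}Q$ then $\mathsf{fix}X.P\xrightarrow{\lambda}Q$; $\mathsf{nil}\xrightarrow{\sigma}\mathsf{nil}$; $\sigma.P\xrightarrow{\sigma}P$; $\lfloor\pi.P\rfloor Q\xrightarrow{\sigma}Q$; if $P\xrightarrow{\sigma}P'$, $Q\xrightarrow{\sigma}Q'$ and $P\parallel Q$ has no $\tau$-transition then $P\parallel Q\xrightarrow{\sigma}P'\parallel Q'$. Network transitions $M\xrightarrow{\nu}M'$, $\nu\in\{\sigma,\tau,a,\overline cv@h,cv@h\}$, are the least relation closed under (for a node $n[\mathcal I\bowtie P]^\mu_h$): if $P\xrightarrow{@h}P'$ then node $\xrightarrow{\tau}n[\mathcal I\bowtie P']^\mu_h$; if $\mathcal I(s)=v$ and $P\xrightarrow{s?v}P'$ then node $\xrightarrow{\tau}n[\mathcal I\bowtie P']^\mu_h$; if $\mathcal I(a)=v$ and $P\xrightarrow{a!v}P'$ then node $\xrightarrow{\tau}n[\mathcal I\bowtie P']^\mu_h$; if $\mathcal I(a)\ne v$ and $P\xrightarrow{a!v}P'$ then node $\xrightarrow{a}n[\mathcal I[a\mapsto v]\bowtie P']^\mu_h$; if $P\xrightarrow{\tau}P'$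 then node $\xrightarrow{\tau}n[\mathcal I\bowtie P']^\mu_h$; if $P\xrightarrow{\sigma}P'$ and the node has no $\tau$-transition then $n[\mathcal I\bowtie P]^{\mathsf s}_h\xrightarrow{\sigma}n[\mathcal I\bowtie P']^{\mathsf s}_h$ and $n[\mathcal I\bowtie P]^{\mathsf m}_h\xrightarrow{\sigma}n[\mathcal I\bowtie P']^{\mathsf m}_k$ for every $k$ with $d(h,k)\le\delta$; if $P\xrightarrow{\overline cv}P'$ (resp. $\xrightarrow{cv}$) and $\mathrm{rng}(c)\ge0$ then node $\xrightarrow{\overline cv@h}$ (resp. $\xrightarrow{cv@h}$) $n[\mathcal I\bowtie P']^\mu_h$; if $M\xrightarrow{\overline cv@k}M'$, $N\xrightarrow{cv@h}N'$ and $d(h,k)\le\mathrm{rng}(c)$ then $M\mid N\xrightarrow{\tau}M'\mid N'$ and $N\mid M\xrightarrow{\tau}N'\mid M'$; if $M\xrightarrow{\nu}M'$, $\nu\ne\sigma$, then $M\mid N\xrightarrow{\nu}M'\mid N$ and $N\mid M\xrightarrow{\nu}N\mid M'$; if $M\xrightarrow{\sigma}M'$, $N\xrightarrow{\sigma}N'$ and $M\mid N$ has no $\tau$-transition then $M\mid N\xrightarrow{\sigma}M'\mid N'$; $\mathbf 0\xrightarrow{\sigma}\mathbf 0$; if $M\xrightarrow{\nu}N$ and $\nu$ is not of the form $\overline cv@h$ or $cv@h$ then $(\nu c)M\xrightarrow{\nu}(\nu c)N$. Barb: $M\downarrow_{a!v@h}$ iff $M\equiv(\nu\tilde g)(n[\mathcal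 I\bowtie P]^\mu_h\mid M')$ with $\mathcal I(a)=v$. Sensor update: $n[\mathcal I\bowtie P]^\mu_h[s@h\mapsto v]=n[\mathcal I[s\mapsto v]\bowtie P]^\mu_h$ if $\mathcal I(s)$ is defined; a node is unchanged if $\mathcal I(s)$ is undefined or it is located at $k\ne h$; the update distributes over $\mid$ and $(\nu c)$, and $\mathbf 0[s@h\mapsto v]=\mathbf 0$. Extensional semantics: the transitions labelled $\tau,\sigma,a$ are those above; in addition (i) if $M\xrightarrow{\overline cv@h}M'$ and $d(h,k)\le\mathrm{rng}(c)$ then $M\xrightarrow{\overline cv\triangleright k}M'$; (ii) if $M\xrightarrow{cv@h}M'$ and $d(k,h)\le\mathrm{rng}(c)$ then $M\xrightarrow{cv\triangleleft k}M'$; (iii) for every sensor $s$, location $h$ and $v$ in the domain of $s$, $M\xrightarrow{s?v@h}M[s@h\mapsto v]$; (iv) if $M\downarrow_{a!v@h}$ then $M\xrightarrow{a!v@h}M$. Let $\alpha$ range over extensional labels. $\Rightarrow$ is $(\xrightarrow{\tau})^*$, $\xRightarrow{\alpha}$ is $\Rightarrow\xrightarrow{\alpha}\Rightarrow$, and $\xRightarrow{\hat\alpha}$ is $\Rightarrow$ if $\alpha=\tau$ and $\xRightarrow{\alpha}$ otherwise. A symmetric relation $\mathcal R$ is a bisimulation if $M\,\mathcal R\,N$ and $M\xrightarrow{\alpha}M'$ imply $N\xRightarrow{\hat\alpha}N'$ with $M'\,\mathcal R\,N'$; $\approx$ is the union of all bisimulations. Expansion: a relation $\mathcal R$ is an expansion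 if $M\,\mathcal R\,N$ implies (a) $M\xrightarrow{\alpha}M'$ gives $N'$ with $M'\,\mathcal R\,N'$ and either $N\xrightarrow{\alpha}N'$, or $\alpha=\tau$ and $N'=N$; (b) $N\xrightarrow{\alpha}N'$ gives $M\xRightarrow{\alpha}M'$ (for $\alpha=\tau$, at least one $\tau$-step) with $M'\,\mathcal R\,N'$; $M\gtrsim N$ iff $M\,\mathcal R\,N$ for some expansion $\mathcal R$ (in particular $M\gtrsim N$ implies $M\approx N$). -}

module Defs where

open import Data.Nat using (ℕ; _≤_; _+_)
open import Data.Nat.Properties using () renaming (_≟_ to _≟ℕ_)
open import Data.Bool using (Bool; true; false; if_then_else_)
open import Data.Maybe using (Maybe; just; nothing)
open import Data.List using (List; []; _∷_; _++_; map)
open import Data.List.Relation.Unary.All using (All)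
open import Data.List.Relation.Unary.Any using (Any)
open import Data.List.Relation.Unary.AllPairs using (AllPairs)
open import Data.Product using (Σ; ∃; ∃₂; _×_; _,_)
open import Data.Sum using (_⊎_)
open import Data.Empty using (⊥)
open import Data.Unit using (⊤)
open import Relation.Nullary using (¬_; does; yes; no)
open import Relation.Binary using (Symmetric)
open import Relation.Binary.Definitions using (DecidableEquality)
open import Relation.Binary.PropositionalEquality using (_≡_; _≢_)
open import Relation.Binary.Construct.Closure.ReflexiveTransitive using (Star)

data Rng : Set where
  neg1 : Rng          -- -1 : internal (intra-node) channel
  fin  : ℕ → Rng
  inf  : Rng

_≤ʳ_ : ℕ → Rng → Set
n ≤ʳ neg1  = ⊥
n ≤ʳ fin m = n ≤ m
n ≤ʳ inf   = ⊤

NonNeg : Rng → Set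
NonNeg neg1    = ⊥
NonNeg (fin _) = ⊤
NonNeg inf     = ⊤

data Mob : Set where
  stat mob : Mob

record Setting : Set₁ where
  field
    Loc    : Set
    _≟L_   : DecidableEquality Loc
    d      : Loc → Loc → ℕ
    d-refl : ∀ h → d h h ≡ 0
    d-sym  : ∀ h k → d h k ≡ d k h
    d-tri  : ∀ h k l → d h l ≤ d h k + d k l
    δ      : ℕ
    Chan   : Set
    rng    : Chan → Rng
    Val    : Set
    locV   : Loc → Val
    -- sensors: node-dependent (false) or location-dependent (true)
    Sens   : Set
    _≟S_   : DecidableEquality Sens
    locDep : Sens → Bool
    SensDom : Sens → Val → Set
    Act    : Set
    _≟A_   : DecidableEquality Act
    NName  : Set
    Pred   : Set
    ⟦_⟧    : Pred → List Val → Bool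

module CaIT (S : Setting) where
  open Setting S

  VVar : Set
  VVar = ℕ

  PVar : Set
  PVar = ℕ

  data VTerm : Set where
    var : VVar → VTerm
    val : Val → VTerm

  data Guard : Set where
    gd : Pred → List VTerm → Guard

  data Proc : Set where
    nil  : Proc
    tick : Proc → Proc
    at   : VVar → Proc → Proc
    rd   : Sens → VVar → Proc → Proc
    wr   : Act → VTerm → Proc → Proc
    _∥_  : Proc → Proc → Proc
    tout : Chan → VTerm → Proc → Proc → Proc  -- ⌊ c̄⟨v⟩.P ⌋ Q
    tin  : Chan → VVar → Proc → Proc → Proc   -- ⌊ c(x).P ⌋ Q
    cond : Guard → Proc → Proc → Proc
    pv   : PVar → Proc
    fix  : PVar → Proc → Proc

  infixr 5 _∥_

  record Iface : Set where
    field
      isens : Sens → Maybe Val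
      iact  : Act → Maybe Val
  open Iface public

  ∅I : Iface
  ∅I = record { isens = λ _ → nothing ; iact = λ _ → nothing }

  data Net : Set where
    𝟎    : Net
    node : NName → Iface → Proc → Mob → Loc → Net   -- n[I ⋈ P]^μ_h
    _∣_  : Net → Net → Net
    ν    : Chan → Net → Net

  infixr 4 _∣_

  nus : List Chan → Net → Net
  nus []       M = M
  nus (c ∷ cs) M = ν c (nus cs M)

  -- Substitutions (only closed things are ever substituted).

  subT : VVar → Val → VTerm → VTerm
  subT x v (var y) = if does (x ≟ℕ y) then val v else var y
  subT x v (val w) = val w

  subG : VVar → Val → Guard → Guard
  subG x v (gd p ts) = gd p (map (subT x v) ts)

  substV : Proc → Val → VVar → Proc
  substV nil v x = nil
  substV (tick P) v x = tick (substV P v x)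
  substV (at y P) v x = at y (if does (x ≟ℕ y) then P else substV P v x)
  substV (rd s y P) v x = rd s y (if does (x ≟ℕ y) then P else substV P v x)
  substV (wr a t P) v x = wr a (subT x v t) (substV P v x)
  substV (P ∥ Q) v x = substV P v x ∥ substV Q v x
  substV (tout c t P Q) v x = tout c (subT x v t) (substV P v x) (substV Q v x)
  substV (tin c y P Q) v x =
    tin c y (if does (x ≟ℕ y) then P else substV P v x) (substV Q v x)
  substV (cond b P Q) v x = cond (subG x v b) (substV P v x) (substV Q v x)
  substV (pv X) v x = pv X
  substV (fix X P) v x = fix X (substV P v x)

  substP : Proc → Proc → PVar → Proc
  substP nil R X = nil
  substP (tick P) R X = tick (substP P R X)
  substP (at y P) R X = at y (substP P R X)
  substP (rd s y P) R X = rd s y (substP P R X)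
  substP (wr a t P) R X = wr a t (substP P R X)
  substP (P ∥ Q) R X = substP P R X ∥ substP Q R X
  substP (tout c t P Q) R X = tout c t (substP P R X) (substP Q R X)
  substP (tin c y P Q) R X = tin c y (substP P R X) (substP Q R X)
  substP (cond b P Q) R X = cond b (substP P R X) (substP Q R X)
  substP (pv Y) R X = if does (X ≟ℕ Y) then R else pv Y
  substP (fix Y P) R X = fix Y (if does (X ≟ℕ Y) then P else substP P R X)

  closedArgs : List VTerm → Maybe (List Val)
  closedArgs [] = just []
  closedArgs (var _ ∷ ts) = nothing
  closedArgs (val v ∷ ts) with closedArgs ts
  ... | just vs = just (v ∷ vs)
  ... | nothing = nothing

  evalG : Guard → Maybe Bool
  evalG (gd p ts) with closedArgs ts
  ... | just vs = just (⟦ p ⟧ vs)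
  ... | nothing = nothing

  FV : VVar → Proc → Set
  FVt : VVar → VTerm → Set
  FVt x (var y) = x ≡ y
  FVt x (val _) = ⊥
  FV x nil = ⊥
  FV x (tick P) = FV x P
  FV x (at y P) = x ≢ y × FV x P
  FV x (rd s y P) = x ≢ y × FV x P
  FV x (wr a t P) = FVt x t ⊎ FV x P
  FV x (P ∥ Q) = FV x P ⊎ FV x Q
  FV x (tout c t P Q) = FVt x t ⊎ FV x P ⊎ FV x Q
  FV x (tin c y P Q) = (x ≢ y × FV x P) ⊎ FV x Q
  FV x (cond (gd p ts) P Q) = Any (FVt x) ts ⊎ FV x P ⊎ FV x Q
  FV x (pv X) = ⊥
  FV x (fix X P) = FV x P

  FPV : PVar → Proc → Set
  FPV X nil = ⊥
  FPV X (tick P) = FPV X P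
  FPV X (at y P) = FPV X P
  FPV X (rd s y P) = FPV X P
  FPV X (wr a t P) = FPV X P
  FPV X (P ∥ Q) = FPV X P ⊎ FPV X Q
  FPV X (tout c t P Q) = FPV X P ⊎ FPV X Q
  FPV X (tin c y P Q) = FPV X P ⊎ FPV X Q
  FPV X (cond b P Q) = FPV X P ⊎ FPV X Q
  FPV X (pv Y) = X ≡ Y
  FPV X (fix Y P) = X ≢ Y × FPV X P

  -- every free occurrence of X in P is time-guarded
  -- (i.e. lies under a σ-prefix or in the timeout branch Q of ⌊π.P⌋Q)
  TGuarded : PVar → Proc → Set
  TGuarded X nil = ⊤
  TGuarded X (tick P) = ⊤
  TGuarded X (at y P) = TGuarded X P
  TGuarded X (rd s y P) = TGuarded X P
  TGuarded X (wr a t P) = TGuarded X P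
  TGuarded X (P ∥ Q) = TGuarded X P × TGuarded X Q
  TGuarded X (tout c t P Q) = TGuarded X P
  TGuarded X (tin c y P Q) = TGuarded X P
  TGuarded X (cond b P Q) = TGuarded X P × TGuarded X Q
  TGuarded X (pv Y) = X ≢ Y
  TGuarded X (fix Y P) = X ≡ Y ⊎ TGuarded X P

  FixGuarded : Proc → Set
  FixGuarded nil = ⊤
  FixGuarded (tick P) = FixGuarded P
  FixGuarded (at y P) = FixGuarded P
  FixGuarded (rd s y P) = FixGuarded P
  FixGuarded (wr a t P) = FixGuarded P
  FixGuarded (P ∥ Q) = FixGuarded P × FixGuarded Q
  FixGuarded (tout c t P Q) = FixGuarded P × FixGuarded Q
  FixGuarded (tin c y P Q) = FixGuarded P × FixGuarded Q
  FixGuarded (cond b P Q) = FixGuarded P × FixGuarded Q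
  FixGuarded (pv Y) = ⊤
  FixGuarded (fix X P) = TGuarded X P × FixGuarded P

  SensOcc : Sens → Proc → Set
  SensOcc s nil = ⊥
  SensOcc s (tick P) = SensOcc s P
  SensOcc s (at y P) = SensOcc s P
  SensOcc s (rd s' y P) = s ≡ s' ⊎ SensOcc s P
  SensOcc s (wr a t P) = SensOcc s P
  SensOcc s (P ∥ Q) = SensOcc s P ⊎ SensOcc s Q
  SensOcc s (tout c t P Q) = SensOcc s P ⊎ SensOcc s Q
  SensOcc s (tin c y P Q) = SensOcc s P ⊎ SensOcc s Q
  SensOcc s (cond b P Q) = SensOcc s P ⊎ SensOcc s Q
  SensOcc s (pv Y) = ⊥
  SensOcc s (fix X P) = SensOcc s P

  ActOcc : Act → Proc → Set
  ActOcc a nil = ⊥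
  ActOcc a (tick P) = ActOcc a P
  ActOcc a (at y P) = ActOcc a P
  ActOcc a (rd s y P) = ActOcc a P
  ActOcc a (wr a' t P) = a ≡ a' ⊎ ActOcc a P
  ActOcc a (P ∥ Q) = ActOcc a P ⊎ ActOcc a Q
  ActOcc a (tout c t P Q) = ActOcc a P ⊎ ActOcc a Q
  ActOcc a (tin c y P Q) = ActOcc a P ⊎ ActOcc a Q
  ActOcc a (cond b P Q) = ActOcc a P ⊎ ActOcc a Q
  ActOcc a (pv Y) = ⊥
  ActOcc a (fix X P) = ActOcc a P

  ChanOcc : Chan → Proc → Set
  ChanOcc c nil = ⊥
  ChanOcc c (tick P) = ChanOcc c P
  ChanOcc c (at y P) = ChanOcc c P
  ChanOcc c (rd s y P) = ChanOcc c P
  ChanOcc c (wr a t P) = ChanOcc c P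
  ChanOcc c (P ∥ Q) = ChanOcc c P ⊎ ChanOcc c Q
  ChanOcc c (tout c' t P Q) = c ≡ c' ⊎ ChanOcc c P ⊎ ChanOcc c Q
  ChanOcc c (tin c' y P Q) = c ≡ c' ⊎ ChanOcc c P ⊎ ChanOcc c Q
  ChanOcc c (cond b P Q) = ChanOcc c P ⊎ ChanOcc c Q
  ChanOcc c (pv Y) = ⊥
  ChanOcc c (fix X P) = ChanOcc c P

  ChanOccN : Chan → Net → Set
  ChanOccN c 𝟎 = ⊥
  ChanOccN c (node n I P μ h) = ChanOcc c P
  ChanOccN c (M ∣ N) = ChanOccN c M ⊎ ChanOccN c N
  ChanOccN c (ν c' M) = c ≢ c' × ChanOccN c M

  HasPrefixOrAct : Proc → Set
  HasPrefixOrAct nil = ⊥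
  HasPrefixOrAct (tick P) = HasPrefixOrAct P
  HasPrefixOrAct (at y P) = HasPrefixOrAct P
  HasPrefixOrAct (rd s y P) = HasPrefixOrAct P
  HasPrefixOrAct (wr a t P) = ⊤
  HasPrefixOrAct (P ∥ Q) = HasPrefixOrAct P ⊎ HasPrefixOrAct Q
  HasPrefixOrAct (tout c t P Q) = ⊤
  HasPrefixOrAct (tin c y P Q) = ⊤
  HasPrefixOrAct (cond b P Q) = HasPrefixOrAct P ⊎ HasPrefixOrAct Q
  HasPrefixOrAct (pv Y) = ⊥
  HasPrefixOrAct (fix X P) = HasPrefixOrAct P

  HasAt : Proc → Set
  HasAt nil = ⊥
  HasAt (tick P) = HasAt P
  HasAt (at y P) = ⊤
  HasAt (rd s y P) = HasAt P
  HasAt (wr a t P) = HasAt P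
  HasAt (P ∥ Q) = HasAt P ⊎ HasAt Q
  HasAt (tout c t P Q) = HasAt P ⊎ HasAt Q
  HasAt (tin c y P Q) = HasAt P ⊎ HasAt Q
  HasAt (cond b P Q) = HasAt P ⊎ HasAt Q
  HasAt (pv Y) = ⊥
  HasAt (fix X P) = HasAt P

  Defined : Maybe Val → Set
  Defined m = ∃ λ v → m ≡ just v

  record NodeD : Set where
    constructor nd
    field
      nname : NName
      niface : Iface
      nproc : Proc
      nmob : Mob
      nloc : Loc
  open NodeD public

  nodesOf : Net → List NodeD
  nodesOf 𝟎 = []
  nodesOf (node n I P μ h) = nd n I P μ h ∷ []
  nodesOf (M ∣ N) = nodesOf M ++ nodesOf N
  nodesOf (ν c M) = nodesOf M

  Compatible : NodeD → NodeD → Set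
  Compatible A B =
    nname A ≢ nname B
    × (∀ a → Defined (iact (niface A) a) → ¬ Defined (iact (niface B) a))
    × (∀ s → locDep s ≡ false →
         Defined (isens (niface A) s) → ¬ Defined (isens (niface B) s))

  record NodeOK (A : NodeD) : Set where
    field
      sensOK   : ∀ s → SensOcc s (nproc A) → Defined (isens (niface A) s)
      actOK    : ∀ a → ActOcc a (nproc A) → Defined (iact (niface A) a)
      locDepOK : ∀ s → locDep s ≡ true → Defined (isens (niface A) s) →
                 nmob A ≡ stat
      closedV  : ∀ x → ¬ FV x (nproc A)
      closedP  : ∀ X → ¬ FPV X (nproc A)
      guarded  : FixGuarded (nproc A)

  WF : Net → Set
  WF M = AllPairs Compatible (nodesOf M) × All NodeOK (nodesOf M)

  infix 3 _≡ₚ_ _≡ₙ_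

  data _≡ₚ_ : Proc → Proc → Set where
    ≡-refl  : ∀ {P} → P ≡ₚ P
    ≡-sym   : ∀ {P Q} → P ≡ₚ Q → Q ≡ₚ P
    ≡-trans : ∀ {P Q R} → P ≡ₚ Q → Q ≡ₚ R → P ≡ₚ R
    ≡-tick  : ∀ {P P'} → P ≡ₚ P' → tick P ≡ₚ tick P'
    ≡-at    : ∀ {x P P'} → P ≡ₚ P' → at x P ≡ₚ at x P'
    ≡-rd    : ∀ {s x P P'} → P ≡ₚ P' → rd s x P ≡ₚ rd s x P'
    ≡-wr    : ∀ {a t P P'} → P ≡ₚ P' → wr a t P ≡ₚ wr a t P'
    ≡-par   : ∀ {P P' Q Q'} → P ≡ₚ P' → Q ≡ₚ Q' → (P ∥ Q) ≡ₚ (P' ∥ Q')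
    ≡-tout  : ∀ {c t P P' Q Q'} → P ≡ₚ P' → Q ≡ₚ Q' →
              tout c t P Q ≡ₚ tout c t P' Q'
    ≡-tin   : ∀ {c x P P' Q Q'} → P ≡ₚ P' → Q ≡ₚ Q' →
              tin c x P Q ≡ₚ tin c x P' Q'
    ≡-cond  : ∀ {b P P' Q Q'} → P ≡ₚ P' → Q ≡ₚ Q' →
              cond b P Q ≡ₚ cond b P' Q'
    ≡-fix   : ∀ {X P P'} → P ≡ₚ P' → fix X P ≡ₚ fix X P'
    ∥-comm  : ∀ {P Q} → (P ∥ Q) ≡ₚ (Q ∥ P)
    ∥-assoc : ∀ {P Q R} → ((P ∥ Q) ∥ R) ≡ₚ (P ∥ (Q ∥ R))
    ∥-unit  : ∀ {P} → (P ∥ nil) ≡ₚ P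
    if-true  : ∀ {b P Q} → evalG b ≡ just true  → cond b P Q ≡ₚ P
    if-false : ∀ {b P Q} → evalG b ≡ just false → cond b P Q ≡ₚ Q
    fix-unf : ∀ {X P} → fix X P ≡ₚ substP P (fix X P) X

  data _≡ₙ_ : Net → Net → Set where
    ≡-refl  : ∀ {M} → M ≡ₙ M
    ≡-sym   : ∀ {M N} → M ≡ₙ N → N ≡ₙ M
    ≡-trans : ∀ {M N L} → M ≡ₙ N → N ≡ₙ L → M ≡ₙ L
    ≡-node  : ∀ {n I P Q μ h} → P ≡ₚ Q → node n I P μ h ≡ₙ node n I Q μ h
    ≡-par   : ∀ {M M' N N'} → M ≡ₙ M' → N ≡ₙ N' → (M ∣ N) ≡ₙ (M' ∣ N')
    ≡-res   : ∀ {c M N} → M ≡ₙ N → ν c M ≡ₙ ν c N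
    ∣-comm  : ∀ {M N} → (M ∣ N) ≡ₙ (N ∣ M)
    ∣-assoc : ∀ {M N L} → ((M ∣ N) ∣ L) ≡ₙ (M ∣ (N ∣ L))
    ∣-unit  : ∀ {M} → (M ∣ 𝟎) ≡ₙ M
    ν-zero  : ∀ {c} → ν c 𝟎 ≡ₙ 𝟎
    ν-swap  : ∀ {c d M} → ν c (ν d M) ≡ₙ ν d (ν c M)
    ν-extr  : ∀ {c M N} → ¬ ChanOccN c M → ν c (M ∣ N) ≡ₙ (M ∣ ν c N)

  data PLab : Set where
    lτ   : PLab
    lout : Chan → Val → PLab
    linp : Chan → Val → PLab
    lat  : Loc → PLab
    lrd  : Sens → Val → PLab
    lwr  : Act → Val → PLab

  data _─[_]→_ : Proc → PLab → Proc → Set where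
    p-out  : ∀ {c v P Q} → tout c (val v) P Q ─[ lout c v ]→ P
    p-inp  : ∀ {c x P Q} v → tin c x P Q ─[ linp c v ]→ substV P v x
    p-rd   : ∀ {s x P} v → rd s x P ─[ lrd s v ]→ substV P v x
    p-wr   : ∀ {a v P} → wr a (val v) P ─[ lwr a v ]→ P
    p-at   : ∀ {x P} h → at x P ─[ lat h ]→ substV P (locV h) x
    p-comL : ∀ {P P' Q Q' c v} → P ─[ lout c v ]→ P' → Q ─[ linp c v ]→ Q' →
             rng c ≡ neg1 → (P ∥ Q) ─[ lτ ]→ (P' ∥ Q')
    p-comR : ∀ {P P' Q Q' c v} → P ─[ lout c v ]→ P' → Q ─[ linp c v ]→ Q' →
             rng c ≡ neg1 → (Q ∥ P) ─[ lτ ]→ (Q' ∥ P')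
    p-parL : ∀ {P P' Q l} → P ─[ l ]→ P' → (P ∥ Q) ─[ l ]→ (P' ∥ Q)
    p-parR : ∀ {P P' Q l} → P ─[ l ]→ P' → (Q ∥ P) ─[ l ]→ (Q ∥ P')
    p-fix  : ∀ {X P Q l} → substP P (fix X P) X ─[ l ]→ Q → fix X P ─[ l ]→ Q
    p-ifT  : ∀ {b P P' Q l} → evalG b ≡ just true → P ─[ l ]→ P' →
             cond b P Q ─[ l ]→ P'
    p-ifF  : ∀ {b P Q Q' l} → evalG b ≡ just false → Q ─[ l ]→ Q' →
             cond b P Q ─[ l ]→ Q'

  data _─σ→_ : Proc → Proc → Set where
    t-nil  : nil ─σ→ nil
    t-tick : ∀ {P} → tick P ─σ→ P
    t-tout : ∀ {c t P Q} → tout c t P Q ─σ→ Q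
    t-tin  : ∀ {c x P Q} → tin c x P Q ─σ→ Q
    t-par  : ∀ {P P' Q Q'} → P ─σ→ P' → Q ─σ→ Q' →
             ¬ (∃ λ R → (P ∥ Q) ─[ lτ ]→ R) → (P ∥ Q) ─σ→ (P' ∥ Q')
    t-fix  : ∀ {X P Q} → substP P (fix X P) X ─σ→ Q → fix X P ─σ→ Q
    t-ifT  : ∀ {b P P' Q} → evalG b ≡ just true → P ─σ→ P' →
             cond b P Q ─σ→ P'
    t-ifF  : ∀ {b P Q Q'} → evalG b ≡ just false → Q ─σ→ Q' →
             cond b P Q ─σ→ Q'

  updA : Iface → Act → Val → Iface
  updA I a v = record I { iact = λ b → if does (a ≟A b) then just v else iact I b }

  updSI : Iface → Sens → Val → Iface
  updSI I s v = record I { isens = λ s' → if does (s ≟S s') then just v else isens I s' }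

  data NLab : Set where
    nτ   : NLab
    nact : Act → NLab
    nout : Chan → Val → Loc → NLab
    ninp : Chan → Val → Loc → NLab

  NotOn : Chan → NLab → Set
  NotOn c (nout c' v h) = c' ≢ c
  NotOn c (ninp c' v h) = c' ≢ c
  NotOn c _ = ⊤

  data _═[_]⇒_ : Net → NLab → Net → Set where
    n-at    : ∀ {n I P P' μ h} → P ─[ lat h ]→ P' →
              node n I P μ h ═[ nτ ]⇒ node n I P' μ h
    n-rd    : ∀ {n I P P' μ h s v} → isens I s ≡ just v → P ─[ lrd s v ]→ P' →
              node n I P μ h ═[ nτ ]⇒ node n I P' μ h
    n-wr    : ∀ {n I P P' μ h a v} → iact I a ≡ just v → P ─[ lwr a v ]→ P' →
              node n I P μ h ═[ nτ ]⇒ node n I P' μ h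
    n-wrchg : ∀ {n I P P' μ h a v} → ¬ (iact I a ≡ just v) → P ─[ lwr a v ]→ P' →
              node n I P μ h ═[ nact a ]⇒ node n (updA I a v) P' μ h
    n-τ     : ∀ {n I P P' μ h} → P ─[ lτ ]→ P' →
              node n I P μ h ═[ nτ ]⇒ node n I P' μ h
    n-out   : ∀ {n I P P' μ h c v} → P ─[ lout c v ]→ P' → NonNeg (rng c) →
              node n I P μ h ═[ nout c v h ]⇒ node n I P' μ h
    n-inp   : ∀ {n I P P' μ h c v} → P ─[ linp c v ]→ P' → NonNeg (rng c) →
              node n I P μ h ═[ ninp c v h ]⇒ node n I P' μ h
    n-comL  : ∀ {M M' N N' c v h k} → M ═[ nout c v k ]⇒ M' → N ═[ ninp c v h ]⇒ N' →
              d h k ≤ʳ rng c → (M ∣ N) ═[ nτ ]⇒ (M' ∣ N')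
    n-comR  : ∀ {M M' N N' c v h k} → M ═[ nout c v k ]⇒ M' → N ═[ ninp c v h ]⇒ N' →
              d h k ≤ʳ rng c → (N ∣ M) ═[ nτ ]⇒ (N' ∣ M')
    n-parL  : ∀ {M M' N l} → M ═[ l ]⇒ M' → (M ∣ N) ═[ l ]⇒ (M' ∣ N)
    n-parR  : ∀ {M M' N l} → M ═[ l ]⇒ M' → (N ∣ M) ═[ l ]⇒ (N ∣ M')
    n-res   : ∀ {c M N l} → M ═[ l ]⇒ N → NotOn c l → ν c M ═[ l ]⇒ ν c N

  data _═σ⇒_ : Net → Net → Set where
    s-stat : ∀ {n I P P' h} → P ─σ→ P' →
             ¬ (∃ λ N → node n I P stat h ═[ nτ ]⇒ N) →
             node n I P stat h ═σ⇒ node n I P' stat h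
    s-mob  : ∀ {n I P P' h k} → P ─σ→ P' →
             ¬ (∃ λ N → node n I P mob h ═[ nτ ]⇒ N) → d h k ≤ δ →
             node n I P mob h ═σ⇒ node n I P' mob k
    s-par  : ∀ {M M' N N'} → M ═σ⇒ M' → N ═σ⇒ N' →
             ¬ (∃ λ L → (M ∣ N) ═[ nτ ]⇒ L) → (M ∣ N) ═σ⇒ (M' ∣ N')
    s-zero : 𝟎 ═σ⇒ 𝟎
    s-res  : ∀ {c M N} → M ═σ⇒ N → ν c M ═σ⇒ ν c N

  Barb : Net → Act → Val → Loc → Set
  Barb M a v h =
    Σ (List Chan) λ gs → Σ NName λ n → Σ Iface λ I → Σ Proc λ P →
    Σ Mob λ μ → Σ Net λ M' →
      (M ≡ₙ nus gs (node n I P μ h ∣ M')) × iact I a ≡ just v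

  updS : Sens → Loc → Val → Net → Net
  updS s h v 𝟎 = 𝟎
  updS s h v (node n I P μ k) with k ≟L h | isens I s
  ... | yes _ | just _  = node n (updSI I s v) P μ k
  ... | yes _ | nothing = node n I P μ k
  ... | no _  | _       = node n I P μ k
  updS s h v (M ∣ N) = updS s h v M ∣ updS s h v N
  updS s h v (ν c M) = ν c (updS s h v M)

  data ELab : Set where
    eτ    : ELab
    eσ    : ELab
    eact  : Act → ELab
    eout  : Chan → Val → Loc → ELab
    einp  : Chan → Val → Loc → ELab
    esens : Sens → Val → Loc → ELab
    ebarb : Act → Val → Loc → ELab

  data _⟶[_]_ : Net → ELab → Net → Set where
    e-τ    : ∀ {M M'} → M ═[ nτ ]⇒ M' → M ⟶[ eτ ] M'
    e-σ    : ∀ {M M'} → M ═σ⇒ M' → M ⟶[ eσ ] M'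
    e-act  : ∀ {M M' a} → M ═[ nact a ]⇒ M' → M ⟶[ eact a ] M'
    e-out  : ∀ {M M' c v h k} → M ═[ nout c v h ]⇒ M' → d h k ≤ʳ rng c →
             M ⟶[ eout c v k ] M'
    e-inp  : ∀ {M M' c v h k} → M ═[ ninp c v h ]⇒ M' → d k h ≤ʳ rng c →
             M ⟶[ einp c v k ] M'
    e-sens : ∀ {M s v h} → SensDom s v → M ⟶[ esens s v h ] updS s h v M
    e-barb : ∀ {M a v h} → Barb M a v h → M ⟶[ ebarb a v h ] M

  _⇒_ : Net → Net → Set
  _⇒_ = Star (λ M N → M ⟶[ eτ ] N)

  _⇒[_]_ : Net → ELab → Net → Set
  M ⇒[ α ] N = ∃₂ λ M₁ M₂ → (M ⇒ M₁) × (M₁ ⟶[ α ] M₂) × (M₂ ⇒ N)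

  _⇒̂[_]_ : Net → ELab → Net → Set
  M ⇒̂[ eτ ] N = M ⇒ N
  M ⇒̂[ α ] N = M ⇒[ α ] N

  IsBisimulation : (Net → Net → Set) → Set
  IsBisimulation R =
    Symmetric R ×
    (∀ {M N M' α} → R M N → M ⟶[ α ] M' → ∃ λ N' → (N ⇒̂[ α ] N') × R M' N')

  _≈_ : Net → Net → Set₁
  M ≈ N = ∃ λ (R : Net → Net → Set) → IsBisimulation R × R M N

  IsExpansion : (Net → Net → Set) → Set
  IsExpansion R =
    (∀ {M N M' α} → R M N → M ⟶[ α ] M' →
       ∃ λ N' → R M' N' × ((N ⟶[ α ] N') ⊎ (α ≡ eτ × N' ≡ N)))
    × (∀ {M N N' α} → R M N → N ⟶[ α ] N' →
       ∃ λ M' → (M ⇒[ α ] M') × R M' N')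

  _≳_ : Net → Net → Set₁
  M ≳ N = ∃ λ (R : Net → Net → Set) → IsExpansion R × R M N

  infix 2 _≈_ _≳_

-- Laws (1)–(4) each remove one administrative τ-step.  The left-hand network M has a τ-step
-- to the right-hand network N, and every other transition of M is either that very step or is
-- matched by N with the derivatives again of the same shape; since M cannot let time pass
-- while a τ-step is enabled (maximal progress), this relation together with the identity is
-- an expansion.  For (5), a process without communication prefixes or actuator writes can only
-- read sensors or its location; each such step shrinks the part of the process above its time
-- guards, so after finitely many τ-steps it lets time pass whenever the node running nil does.
-- For (6), an empty node without actuators shows no barbs and can only let time pass, like 𝟎.
-- For (7), a process that never asks for its location, has no actuators and uses only
-- internal or unbounded channels cannot tell where its node is or whether it moves.

module Submission where

open import Defs

open import Data.Bool using (true; false; if_then_else_)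
open import Data.Empty using (⊥; ⊥-elim)
import Data.List as List
open import Data.List using (List; []; _∷_; _++_)
open import Data.List.Properties using (++-assoc; ++-identityʳ)
import Data.List.Relation.Unary.All as All
open import Data.List.Relation.Unary.Any as Any using (Any; here; there)
open import Data.List.Relation.Unary.Any.Properties using (map⁻; singleton⁻)
open import Data.List.Relation.Binary.Permutation.Propositional
  using (_↭_; ↭-refl; ↭-sym; ↭-trans; ↭-reflexive)
open import Data.List.Relation.Binary.Permutation.Propositional.Properties
  using (Any-resp-↭; ++⁺; ++-comm)
open import Data.Maybe using (just; nothing)
open import Data.Nat using (ℕ; suc; _+_; _<_; _≤_; z≤n; s≤s; _≡ᵇ_)
open import Data.Nat.Induction using (<-wellFounded)
open import Data.Nat.Properties
  using (_≟_; ≡ᵇ⇒≡; ≡⇒≡ᵇ; ≤-reflexive; <-≤-trans; m<n⇒m<1+n; +-monoˡ-<; +-monoʳ-<;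
         m≤m+n; m≤n+m)
import Data.Product as Product
open import Data.Product using (_×_; _,_; Σ-syntax; ∃; ∃₂; proj₁; proj₂; map₂)
import Data.Sum as Sum
open import Data.Sum using (_⊎_; inj₁; inj₂; [_,_]; map₁)
open import Data.Unit using (⊤; tt)
open import Function using (id; _∘_; flip; case_of_)
open import Induction.WellFounded using (Acc; acc)
open import Relation.Binary.Construct.Closure.ReflexiveTransitive using (ε; _◅_)
open import Relation.Binary.PropositionalEquality
  using (_≡_; _≢_; refl; sym; trans; cong; cong₂; cong-app; subst; subst₂)
open import Relation.Nullary using (¬_; yes; no; does)

module Properties (S : Setting) where
  open Setting S
  open CaIT S

  -- Occurrences of prefixes

  data Prefix : Set where
    at′  : Prefix
    rd′  : Sens → Prefix
    wr′  : Act → Prefix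
    out′ : Chan → Prefix
    in′  : Chan → Prefix

  -- ActOcc, SensOcc, HasAt, ChanOcc and HasPrefixOrAct are all instances of Occ (see the
  -- ⇒Occ / Occ⇒ lemmas), so their preservation along transitions is proved once, via _⊑_.
  Occ : (Prefix → Set) → Proc → Set
  Occ Q nil = ⊥
  Occ Q (tick P) = Occ Q P
  Occ Q (at y P) = Q at′ ⊎ Occ Q P
  Occ Q (rd s y P) = Q (rd′ s) ⊎ Occ Q P
  Occ Q (wr a t P) = Q (wr′ a) ⊎ Occ Q P
  Occ Q (P ∥ R) = Occ Q P ⊎ Occ Q R
  Occ Q (tout c t P R) = Q (out′ c) ⊎ Occ Q P ⊎ Occ Q R
  Occ Q (tin c y P R) = Q (in′ c) ⊎ Occ Q P ⊎ Occ Q R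
  Occ Q (cond b P R) = Occ Q P ⊎ Occ Q R
  Occ Q (pv X) = ⊥
  Occ Q (fix X P) = Occ Q P

  Occ-map : ∀ {Q Q′ : Prefix → Set} → (∀ {p} → Q p → Q′ p) → ∀ P → Occ Q P → Occ Q′ P
  Occ-map f (tick P) o = Occ-map f P o
  Occ-map f (at y P) o = Sum.map f (Occ-map f P) o
  Occ-map f (rd s y P) o = Sum.map f (Occ-map f P) o
  Occ-map f (wr a t P) o = Sum.map f (Occ-map f P) o
  Occ-map f (P ∥ R) o = Sum.map (Occ-map f P) (Occ-map f R) o
  Occ-map f (tout c t P R) o = Sum.map f (Sum.map (Occ-map f P) (Occ-map f R)) o
  Occ-map f (tin c y P R) o = Sum.map f (Sum.map (Occ-map f P) (Occ-map f R)) o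
  Occ-map f (cond b P R) o = Sum.map (Occ-map f P) (Occ-map f R) o
  Occ-map f (fix X P) o = Occ-map f P o

  mutual
    substV-occ : ∀ {Q} P v x → Occ Q (substV P v x) → Occ Q P
    substV-occ nil v x ()
    substV-occ (tick P) v x = substV-occ P v x
    substV-occ (at y P) v x = Sum.map id (binder-occ P v x y)
    substV-occ (rd s y P) v x = Sum.map id (binder-occ P v x y)
    substV-occ (wr a t P) v x = Sum.map id (substV-occ P v x)
    substV-occ (P ∥ R) v x = Sum.map (substV-occ P v x) (substV-occ R v x)
    substV-occ (tout c t P R) v x = Sum.map id (Sum.map (substV-occ P v x) (substV-occ R v x))
    substV-occ (tin c y P R) v x = Sum.map id (Sum.map (binder-occ P v x y) (substV-occ R v x))
    substV-occ (cond b P R) v x = Sum.map (substV-occ P v x) (substV-occ R v x)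
    substV-occ (pv X) v x ()
    substV-occ (fix X P) v x = substV-occ P v x

    binder-occ : ∀ {Q} P v x y → Occ Q (if does (x ≟ y) then P else substV P v x) → Occ Q P
    binder-occ P v x y with does (x ≟ y)
    ... | true = id
    ... | false = substV-occ P v x

  substP-occ : ∀ {Q} P R X → Occ Q (substP P R X) → Occ Q P ⊎ Occ Q R
  substP-occ (tick P) R X o = substP-occ P R X o
  substP-occ (at y P) R X (inj₁ q) = inj₁ (inj₁ q)
  substP-occ (at y P) R X (inj₂ o) = map₁ inj₂ (substP-occ P R X o)
  substP-occ (rd s y P) R X (inj₁ q) = inj₁ (inj₁ q)
  substP-occ (rd s y P) R X (inj₂ o) = map₁ inj₂ (substP-occ P R X o)
  substP-occ (wr a t P) R X (inj₁ q) = inj₁ (inj₁ q)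
  substP-occ (wr a t P) R X (inj₂ o) = map₁ inj₂ (substP-occ P R X o)
  substP-occ (P ∥ P′) R X (inj₁ o) = map₁ inj₁ (substP-occ P R X o)
  substP-occ (P ∥ P′) R X (inj₂ o) = map₁ inj₂ (substP-occ P′ R X o)
  substP-occ (tout c t P P′) R X (inj₁ q) = inj₁ (inj₁ q)
  substP-occ (tout c t P P′) R X (inj₂ (inj₁ o)) = map₁ (inj₂ ∘ inj₁) (substP-occ P R X o)
  substP-occ (tout c t P P′) R X (inj₂ (inj₂ o)) = map₁ (inj₂ ∘ inj₂) (substP-occ P′ R X o)
  substP-occ (tin c y P P′) R X (inj₁ q) = inj₁ (inj₁ q)
  substP-occ (tin c y P P′) R X (inj₂ (inj₁ o)) = map₁ (inj₂ ∘ inj₁) (substP-occ P R X o)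
  substP-occ (tin c y P P′) R X (inj₂ (inj₂ o)) = map₁ (inj₂ ∘ inj₂) (substP-occ P′ R X o)
  substP-occ (cond b P P′) R X (inj₁ o) = map₁ inj₁ (substP-occ P R X o)
  substP-occ (cond b P P′) R X (inj₂ o) = map₁ inj₂ (substP-occ P′ R X o)
  substP-occ (pv Y) R X o with does (X ≟ Y)
  ... | true = inj₂ o
  substP-occ (fix Y P) R X o with does (X ≟ Y)
  ... | true = inj₁ o
  ... | false = substP-occ P R X o

  unfold-occ : ∀ {Q} X P → Occ Q (substP P (fix X P) X) → Occ Q (fix X P)
  unfold-occ X P o = [ id , id ] (substP-occ P (fix X P) X o)

  step-occ : ∀ {Q P P′ l} → P ─[ l ]→ P′ → Occ Q P′ → Occ Q P
  step-occ p-out = inj₂ ∘ inj₁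
  step-occ {P = tin c x P _} (p-inp v) = inj₂ ∘ inj₁ ∘ substV-occ P v x
  step-occ {P = rd s x P} (p-rd v) = inj₂ ∘ substV-occ P v x
  step-occ p-wr = inj₂
  step-occ {P = at x P} (p-at h) = inj₂ ∘ substV-occ P (locV h) x
  step-occ (p-comL s r _) = Sum.map (step-occ s) (step-occ r)
  step-occ (p-comR s r _) = Sum.map (step-occ r) (step-occ s)
  step-occ (p-parL s) = Sum.map (step-occ s) id
  step-occ (p-parR s) = Sum.map id (step-occ s)
  step-occ {P = fix X P} (p-fix s) = unfold-occ X P ∘ step-occ s
  step-occ (p-ifT _ s) = inj₁ ∘ step-occ s
  step-occ (p-ifF _ s) = inj₂ ∘ step-occ s

  σ-occ : ∀ {Q P P′} → P ─σ→ P′ → Occ Q P′ → Occ Q P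
  σ-occ t-nil = id
  σ-occ t-tick = id
  σ-occ t-tout = inj₂ ∘ inj₂
  σ-occ t-tin = inj₂ ∘ inj₂
  σ-occ (t-par s r _) = Sum.map (σ-occ s) (σ-occ r)
  σ-occ {P = fix X P} (t-fix s) = unfold-occ X P ∘ σ-occ s
  σ-occ (t-ifT _ s) = inj₁ ∘ σ-occ s
  σ-occ (t-ifF _ s) = inj₂ ∘ σ-occ s

  Emits : PLab → Prefix → Set
  Emits lτ p = ∃ λ c → p ≡ out′ c    -- a process τ is a communication
  Emits (lout c _) p = p ≡ out′ c
  Emits (linp c _) p = p ≡ in′ c
  Emits (lat _) p = p ≡ at′
  Emits (lrd s _) p = p ≡ rd′ s
  Emits (lwr a _) p = p ≡ wr′ a

  emits : ∀ {P P′ l} → P ─[ l ]→ P′ → Occ (Emits l) P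
  emits p-out = inj₁ refl
  emits (p-inp _) = inj₁ refl
  emits (p-rd _) = inj₁ refl
  emits p-wr = inj₁ refl
  emits (p-at _) = inj₁ refl
  emits {P ∥ _} (p-comL s _ _) = inj₁ (Occ-map (_ ,_) P (emits s))
  emits {_ ∥ P} (p-comR s _ _) = inj₂ (Occ-map (_ ,_) P (emits s))
  emits (p-parL s) = inj₁ (emits s)
  emits (p-parR s) = inj₂ (emits s)
  emits {fix X P} (p-fix s) = unfold-occ X P (emits s)
  emits (p-ifT _ s) = inj₁ (emits s)
  emits (p-ifF _ s) = inj₂ (emits s)

  -- A record, not a function type, so that P′ and P can be inferred from a proof.
  infix 4 _⊑_
  record _⊑_ (P′ P : Proc) : Set₁ where
    constructor ⊑-intro
    field ⊑-occ : ∀ {Q} → Occ Q P′ → Occ Q P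

  step-⊑ : ∀ {P P′ l} → P ─[ l ]→ P′ → P′ ⊑ P
  step-⊑ s = ⊑-intro (step-occ s)

  σ-⊑ : ∀ {P P′} → P ─σ→ P′ → P′ ⊑ P
  σ-⊑ s = ⊑-intro (σ-occ s)

  unfold-⊑ : ∀ X P → substP P (fix X P) X ⊑ fix X P
  unfold-⊑ X P = ⊑-intro (unfold-occ X P)

  OnChan : Chan → Prefix → Set
  OnChan c p = p ≡ out′ c ⊎ p ≡ in′ c

  ActOrComm : Prefix → Set
  ActOrComm (wr′ _) = ⊤
  ActOrComm (out′ _) = ⊤
  ActOrComm (in′ _) = ⊤
  ActOrComm _ = ⊥

  ActOcc⇒Occ : ∀ {a} P → ActOcc a P → Occ (_≡ wr′ a) P
  ActOcc⇒Occ (tick P) = ActOcc⇒Occ P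
  ActOcc⇒Occ (at y P) = inj₂ ∘ ActOcc⇒Occ P
  ActOcc⇒Occ (rd s y P) = inj₂ ∘ ActOcc⇒Occ P
  ActOcc⇒Occ (wr a t P) = Sum.map (λ { refl → refl }) (ActOcc⇒Occ P)
  ActOcc⇒Occ (P ∥ R) = Sum.map (ActOcc⇒Occ P) (ActOcc⇒Occ R)
  ActOcc⇒Occ (tout c t P R) = inj₂ ∘ Sum.map (ActOcc⇒Occ P) (ActOcc⇒Occ R)
  ActOcc⇒Occ (tin c y P R) = inj₂ ∘ Sum.map (ActOcc⇒Occ P) (ActOcc⇒Occ R)
  ActOcc⇒Occ (cond b P R) = Sum.map (ActOcc⇒Occ P) (ActOcc⇒Occ R)
  ActOcc⇒Occ (fix X P) = ActOcc⇒Occ P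

  Occ⇒ActOcc : ∀ {a} P → Occ (_≡ wr′ a) P → ActOcc a P
  Occ⇒ActOcc (tick P) = Occ⇒ActOcc P
  Occ⇒ActOcc (at y P) = [ (λ ()) , Occ⇒ActOcc P ]
  Occ⇒ActOcc (rd s y P) = [ (λ ()) , Occ⇒ActOcc P ]
  Occ⇒ActOcc (wr a t P) = Sum.map (λ { refl → refl }) (Occ⇒ActOcc P)
  Occ⇒ActOcc (P ∥ R) = Sum.map (Occ⇒ActOcc P) (Occ⇒ActOcc R)
  Occ⇒ActOcc (tout c t P R) = [ (λ ()) , Sum.map (Occ⇒ActOcc P) (Occ⇒ActOcc R) ]
  Occ⇒ActOcc (tin c y P R) = [ (λ ()) , Sum.map (Occ⇒ActOcc P) (Occ⇒ActOcc R) ]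
  Occ⇒ActOcc (cond b P R) = Sum.map (Occ⇒ActOcc P) (Occ⇒ActOcc R)
  Occ⇒ActOcc (fix X P) = Occ⇒ActOcc P

  SensOcc⇒Occ : ∀ {s} P → SensOcc s P → Occ (_≡ rd′ s) P
  SensOcc⇒Occ (tick P) = SensOcc⇒Occ P
  SensOcc⇒Occ (at y P) = inj₂ ∘ SensOcc⇒Occ P
  SensOcc⇒Occ (rd s y P) = Sum.map (λ { refl → refl }) (SensOcc⇒Occ P)
  SensOcc⇒Occ (wr a t P) = inj₂ ∘ SensOcc⇒Occ P
  SensOcc⇒Occ (P ∥ R) = Sum.map (SensOcc⇒Occ P) (SensOcc⇒Occ R)
  SensOcc⇒Occ (tout c t P R) = inj₂ ∘ Sum.map (SensOcc⇒Occ P) (SensOcc⇒Occ R)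
  SensOcc⇒Occ (tin c y P R) = inj₂ ∘ Sum.map (SensOcc⇒Occ P) (SensOcc⇒Occ R)
  SensOcc⇒Occ (cond b P R) = Sum.map (SensOcc⇒Occ P) (SensOcc⇒Occ R)
  SensOcc⇒Occ (fix X P) = SensOcc⇒Occ P

  Occ⇒SensOcc : ∀ {s} P → Occ (_≡ rd′ s) P → SensOcc s P
  Occ⇒SensOcc (tick P) = Occ⇒SensOcc P
  Occ⇒SensOcc (at y P) = [ (λ ()) , Occ⇒SensOcc P ]
  Occ⇒SensOcc (rd s y P) = Sum.map (λ { refl → refl }) (Occ⇒SensOcc P)
  Occ⇒SensOcc (wr a t P) = [ (λ ()) , Occ⇒SensOcc P ]
  Occ⇒SensOcc (P ∥ R) = Sum.map (Occ⇒SensOcc P) (Occ⇒SensOcc R)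
  Occ⇒SensOcc (tout c t P R) = [ (λ ()) , Sum.map (Occ⇒SensOcc P) (Occ⇒SensOcc R) ]
  Occ⇒SensOcc (tin c y P R) = [ (λ ()) , Sum.map (Occ⇒SensOcc P) (Occ⇒SensOcc R) ]
  Occ⇒SensOcc (cond b P R) = Sum.map (Occ⇒SensOcc P) (Occ⇒SensOcc R)
  Occ⇒SensOcc (fix X P) = Occ⇒SensOcc P

  HasAt⇒Occ : ∀ P → HasAt P → Occ (_≡ at′) P
  HasAt⇒Occ (tick P) = HasAt⇒Occ P
  HasAt⇒Occ (at y P) _ = inj₁ refl
  HasAt⇒Occ (rd s y P) = inj₂ ∘ HasAt⇒Occ P
  HasAt⇒Occ (wr a t P) = inj₂ ∘ HasAt⇒Occ P
  HasAt⇒Occ (P ∥ R) = Sum.map (HasAt⇒Occ P) (HasAt⇒Occ R)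
  HasAt⇒Occ (tout c t P R) = inj₂ ∘ Sum.map (HasAt⇒Occ P) (HasAt⇒Occ R)
  HasAt⇒Occ (tin c y P R) = inj₂ ∘ Sum.map (HasAt⇒Occ P) (HasAt⇒Occ R)
  HasAt⇒Occ (cond b P R) = Sum.map (HasAt⇒Occ P) (HasAt⇒Occ R)
  HasAt⇒Occ (fix X P) = HasAt⇒Occ P

  Occ⇒HasAt : ∀ P → Occ (_≡ at′) P → HasAt P
  Occ⇒HasAt (tick P) = Occ⇒HasAt P
  Occ⇒HasAt (at y P) _ = tt
  Occ⇒HasAt (rd s y P) = [ (λ ()) , Occ⇒HasAt P ]
  Occ⇒HasAt (wr a t P) = [ (λ ()) , Occ⇒HasAt P ]
  Occ⇒HasAt (P ∥ R) = Sum.map (Occ⇒HasAt P) (Occ⇒HasAt R)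
  Occ⇒HasAt (tout c t P R) = [ (λ ()) , Sum.map (Occ⇒HasAt P) (Occ⇒HasAt R) ]
  Occ⇒HasAt (tin c y P R) = [ (λ ()) , Sum.map (Occ⇒HasAt P) (Occ⇒HasAt R) ]
  Occ⇒HasAt (cond b P R) = Sum.map (Occ⇒HasAt P) (Occ⇒HasAt R)
  Occ⇒HasAt (fix X P) = Occ⇒HasAt P

  ChanOcc⇒Occ : ∀ {c} P → ChanOcc c P → Occ (OnChan c) P
  ChanOcc⇒Occ (tick P) = ChanOcc⇒Occ P
  ChanOcc⇒Occ (at y P) = inj₂ ∘ ChanOcc⇒Occ P
  ChanOcc⇒Occ (rd s y P) = inj₂ ∘ ChanOcc⇒Occ P
  ChanOcc⇒Occ (wr a t P) = inj₂ ∘ ChanOcc⇒Occ P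
  ChanOcc⇒Occ (P ∥ R) = Sum.map (ChanOcc⇒Occ P) (ChanOcc⇒Occ R)
  ChanOcc⇒Occ (tout c t P R) =
    Sum.map (λ { refl → inj₁ refl }) (Sum.map (ChanOcc⇒Occ P) (ChanOcc⇒Occ R))
  ChanOcc⇒Occ (tin c y P R) =
    Sum.map (λ { refl → inj₂ refl }) (Sum.map (ChanOcc⇒Occ P) (ChanOcc⇒Occ R))
  ChanOcc⇒Occ (cond b P R) = Sum.map (ChanOcc⇒Occ P) (ChanOcc⇒Occ R)
  ChanOcc⇒Occ (fix X P) = ChanOcc⇒Occ P

  Occ⇒ChanOcc : ∀ {c} P → Occ (OnChan c) P → ChanOcc c P
  Occ⇒ChanOcc (tick P) = Occ⇒ChanOcc P
  Occ⇒ChanOcc (at y P) = [ [ (λ ()) , (λ ()) ] , Occ⇒ChanOcc P ]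
  Occ⇒ChanOcc (rd s y P) = [ [ (λ ()) , (λ ()) ] , Occ⇒ChanOcc P ]
  Occ⇒ChanOcc (wr a t P) = [ [ (λ ()) , (λ ()) ] , Occ⇒ChanOcc P ]
  Occ⇒ChanOcc (P ∥ R) = Sum.map (Occ⇒ChanOcc P) (Occ⇒ChanOcc R)
  Occ⇒ChanOcc (tout c t P R) =
    Sum.map [ (λ { refl → refl }) , (λ ()) ] (Sum.map (Occ⇒ChanOcc P) (Occ⇒ChanOcc R))
  Occ⇒ChanOcc (tin c y P R) =
    Sum.map [ (λ ()) , (λ { refl → refl }) ] (Sum.map (Occ⇒ChanOcc P) (Occ⇒ChanOcc R))
  Occ⇒ChanOcc (cond b P R) = Sum.map (Occ⇒ChanOcc P) (Occ⇒ChanOcc R)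
  Occ⇒ChanOcc (fix X P) = Occ⇒ChanOcc P

  HasPrefixOrAct⇒Occ : ∀ P → HasPrefixOrAct P → Occ ActOrComm P
  HasPrefixOrAct⇒Occ (tick P) = HasPrefixOrAct⇒Occ P
  HasPrefixOrAct⇒Occ (at y P) = inj₂ ∘ HasPrefixOrAct⇒Occ P
  HasPrefixOrAct⇒Occ (rd s y P) = inj₂ ∘ HasPrefixOrAct⇒Occ P
  HasPrefixOrAct⇒Occ (wr a t P) _ = inj₁ tt
  HasPrefixOrAct⇒Occ (P ∥ R) = Sum.map (HasPrefixOrAct⇒Occ P) (HasPrefixOrAct⇒Occ R)
  HasPrefixOrAct⇒Occ (tout c t P R) _ = inj₁ tt
  HasPrefixOrAct⇒Occ (tin c y P R) _ = inj₁ tt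
  HasPrefixOrAct⇒Occ (cond b P R) = Sum.map (HasPrefixOrAct⇒Occ P) (HasPrefixOrAct⇒Occ R)
  HasPrefixOrAct⇒Occ (fix X P) = HasPrefixOrAct⇒Occ P

  Occ⇒HasPrefixOrAct : ∀ P → Occ ActOrComm P → HasPrefixOrAct P
  Occ⇒HasPrefixOrAct (tick P) = Occ⇒HasPrefixOrAct P
  Occ⇒HasPrefixOrAct (at y P) = [ (λ ()) , Occ⇒HasPrefixOrAct P ]
  Occ⇒HasPrefixOrAct (rd s y P) = [ (λ ()) , Occ⇒HasPrefixOrAct P ]
  Occ⇒HasPrefixOrAct (wr a t P) _ = tt
  Occ⇒HasPrefixOrAct (P ∥ R) = Sum.map (Occ⇒HasPrefixOrAct P) (Occ⇒HasPrefixOrAct R)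
  Occ⇒HasPrefixOrAct (tout c t P R) _ = tt
  Occ⇒HasPrefixOrAct (tin c y P R) _ = tt
  Occ⇒HasPrefixOrAct (cond b P R) = Sum.map (Occ⇒HasPrefixOrAct P) (Occ⇒HasPrefixOrAct R)
  Occ⇒HasPrefixOrAct (fix X P) = Occ⇒HasPrefixOrAct P

  ActOcc-⊑ : ∀ {a P′ P} → P′ ⊑ P → ActOcc a P′ → ActOcc a P
  ActOcc-⊑ {P′ = P′} {P} (⊑-intro le) = Occ⇒ActOcc P ∘ le ∘ ActOcc⇒Occ P′

  SensOcc-⊑ : ∀ {s P′ P} → P′ ⊑ P → SensOcc s P′ → SensOcc s P
  SensOcc-⊑ {P′ = P′} {P} (⊑-intro le) = Occ⇒SensOcc P ∘ le ∘ SensOcc⇒Occ P′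

  HasAt-⊑ : ∀ {P′ P} → P′ ⊑ P → HasAt P′ → HasAt P
  HasAt-⊑ {P′ = P′} {P} (⊑-intro le) = Occ⇒HasAt P ∘ le ∘ HasAt⇒Occ P′

  ChanOcc-⊑ : ∀ {c P′ P} → P′ ⊑ P → ChanOcc c P′ → ChanOcc c P
  ChanOcc-⊑ {P′ = P′} {P} (⊑-intro le) = Occ⇒ChanOcc P ∘ le ∘ ChanOcc⇒Occ P′

  HasPrefixOrAct-⊑ : ∀ {P′ P} → P′ ⊑ P → HasPrefixOrAct P′ → HasPrefixOrAct P
  HasPrefixOrAct-⊑ {P′ = P′} {P} (⊑-intro le) = Occ⇒HasPrefixOrAct P ∘ le ∘ HasPrefixOrAct⇒Occ P′

  wr-occurs : ∀ {a v P P′} → P ─[ lwr a v ]→ P′ → ActOcc a P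
  wr-occurs {P = P} s = Occ⇒ActOcc P (emits s)

  out-occurs : ∀ {c v P P′} → P ─[ lout c v ]→ P′ → ChanOcc c P
  out-occurs {P = P} s = Occ⇒ChanOcc P (Occ-map inj₁ P (emits s))

  inp-occurs : ∀ {c v P P′} → P ─[ linp c v ]→ P′ → ChanOcc c P
  inp-occurs {P = P} s = Occ⇒ChanOcc P (Occ-map inj₂ P (emits s))

  at-occurs : ∀ {h P P′} → P ─[ lat h ]→ P′ → HasAt P
  at-occurs {P = P} s = Occ⇒HasAt P (emits s)

  -- Barbs, sensor updates and node transitions

  -- All that a barb observes of a network; structural congruence only permutes it.
  sites : Net → List (Iface × Loc)
  sites 𝟎 = []
  sites (node n I P μ h) = (I , h) ∷ []
  sites (M ∣ N) = sites M ++ sites N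
  sites (ν c M) = sites M

  sites-nus : ∀ gs M → sites (nus gs M) ≡ sites M
  sites-nus [] M = refl
  sites-nus (g ∷ gs) M = sites-nus gs M

  ≡ₙ⇒sites-↭ : ∀ {M N} → M ≡ₙ N → sites M ↭ sites N
  ≡ₙ⇒sites-↭ ≡-refl = ↭-refl
  ≡ₙ⇒sites-↭ (≡-sym e) = ↭-sym (≡ₙ⇒sites-↭ e)
  ≡ₙ⇒sites-↭ (≡-trans e e′) = ↭-trans (≡ₙ⇒sites-↭ e) (≡ₙ⇒sites-↭ e′)
  ≡ₙ⇒sites-↭ (≡-node _) = ↭-refl
  ≡ₙ⇒sites-↭ (≡-par e e′) = ++⁺ (≡ₙ⇒sites-↭ e) (≡ₙ⇒sites-↭ e′)
  ≡ₙ⇒sites-↭ (≡-res e) = ≡ₙ⇒sites-↭ e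
  ≡ₙ⇒sites-↭ (∣-comm {M} {N}) = ++-comm (sites M) (sites N)
  ≡ₙ⇒sites-↭ (∣-assoc {M} {N} {L}) = ↭-reflexive (++-assoc (sites M) (sites N) (sites L))
  ≡ₙ⇒sites-↭ (∣-unit {M}) = ↭-reflexive (++-identityʳ (sites M))
  ≡ₙ⇒sites-↭ ν-zero = ↭-refl
  ≡ₙ⇒sites-↭ ν-swap = ↭-refl
  ≡ₙ⇒sites-↭ (ν-extr _) = ↭-refl

  Displays : Act → Val → Loc → Iface × Loc → Set
  Displays a v h (I , k) = iact I a ≡ just v × k ≡ h

  barb⇒sites : ∀ {M a v h} → Barb M a v h → Any (Displays a v h) (sites M)
  barb⇒sites (gs , n , I , P , μ , M′ , M≡ , Ia≡v) =
    Any-resp-↭ (↭-sym (≡ₙ⇒sites-↭ M≡))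
      (subst (Any _) (sym (sites-nus gs _)) (here (Ia≡v , refl)))

  node-barb⁻ : ∀ {n I P μ h a v k} → Barb (node n I P μ h) a v k → iact I a ≡ just v × h ≡ k
  node-barb⁻ = singleton⁻ ∘ barb⇒sites

  node-barb : ∀ {n I P μ h a v} → iact I a ≡ just v → Barb (node n I P μ h) a v h
  node-barb {n} {I} {P} {μ} Ia≡v = [] , n , I , P , μ , 𝟎 , ≡-sym ∣-unit , Ia≡v

  sensorUpdate : Sens → Loc → Val → Iface → Loc → Iface
  sensorUpdate s h v I k with k ≟L h | isens I s
  ... | yes _ | just _ = updSI I s v
  ... | yes _ | nothing = I
  ... | no _  | _ = I

  updS-node : ∀ s h v n I P μ k →
              updS s h v (node n I P μ k) ≡ node n (sensorUpdate s h v I k) P μ k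
  updS-node s h v n I P μ k with k ≟L h | isens I s
  ... | yes _ | just _ = refl
  ... | yes _ | nothing = refl
  ... | no _  | _ = refl

  iact-sensorUpdate : ∀ s h v I k → iact (sensorUpdate s h v I k) ≡ iact I
  iact-sensorUpdate s h v I k with k ≟L h | isens I s
  ... | yes _ | just _ = refl
  ... | yes _ | nothing = refl
  ... | no _  | _ = refl

  Defined-sensorUpdate : ∀ s h v I k s′ → Defined (isens I s′) →
                         Defined (isens (sensorUpdate s h v I k) s′)
  Defined-sensorUpdate s h v I k s′ d with k ≟L h | isens I s
  ... | yes _ | nothing = d
  ... | no _  | _ = d
  ... | yes _ | just _ with s ≟S s′
  ...   | yes _ = v , refl
  ...   | no _ = d

  updS-∅I : ∀ s h v n P μ k → updS s h v (node n ∅I P μ k) ≡ node n ∅I P μ k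
  updS-∅I s h v n P μ k with k ≟L h
  ... | yes _ = refl
  ... | no _ = refl

  -- The node rules: how a process step with label pl surfaces at a node with interface I at h.
  data Promote (I : Iface) (h : Loc) : PLab → NLab → Iface → Set where
    at-τ   : Promote I h (lat h) nτ I
    rd-τ   : ∀ {s v} → isens I s ≡ just v → Promote I h (lrd s v) nτ I
    wr-τ   : ∀ {a v} → iact I a ≡ just v → Promote I h (lwr a v) nτ I
    wr-act : ∀ {a v} → ¬ (iact I a ≡ just v) → Promote I h (lwr a v) (nact a) (updA I a v)
    τ-τ    : Promote I h lτ nτ I
    out    : ∀ {c v} → NonNeg (rng c) → Promote I h (lout c v) (nout c v h) I
    inp    : ∀ {c v} → NonNeg (rng c) → Promote I h (linp c v) (ninp c v h) I

  data NodeStep (n : NName) (I : Iface) (P : Proc) (μ : Mob) (h : Loc) (l : NLab) : Net → Set where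
    step : ∀ {pl P′ I′} → P ─[ pl ]→ P′ → Promote I h pl l I′ →
           NodeStep n I P μ h l (node n I′ P′ μ h)

  node-inv : ∀ {n I P μ h l N} → node n I P μ h ═[ l ]⇒ N → NodeStep n I P μ h l N
  node-inv (n-at s) = step s at-τ
  node-inv (n-rd e s) = step s (rd-τ e)
  node-inv (n-wr e s) = step s (wr-τ e)
  node-inv (n-wrchg e s) = step s (wr-act e)
  node-inv (n-τ s) = step s τ-τ
  node-inv (n-out s c≥0) = step s (out c≥0)
  node-inv (n-inp s c≥0) = step s (inp c≥0)

  node-step : ∀ {n I h pl l I′ P P′ μ} → Promote I h pl l I′ → P ─[ pl ]→ P′ →
              node n I P μ h ═[ l ]⇒ node n I′ P′ μ h
  node-step at-τ = n-at
  node-step (rd-τ e) = n-rd e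
  node-step (wr-τ e) = n-wr e
  node-step (wr-act e) = n-wrchg e
  node-step τ-τ = n-τ
  node-step (out c≥0) s = n-out s c≥0
  node-step (inp c≥0) s = n-inp s c≥0

  -- Expansion by an administrative step

  maximal-progress : ∀ {M M′} → M ═σ⇒ M′ → ¬ (∃ λ N → M ═[ nτ ]⇒ N)
  maximal-progress (s-stat _ noτ) = noτ
  maximal-progress (s-mob _ noτ _) = noτ
  maximal-progress (s-par _ _ noτ) = noτ
  maximal-progress s-zero (_ , ())
  maximal-progress (s-res σ) (_ , n-res t _) = maximal-progress σ (_ , t)

  Fires : (Net → Net → Set) → Set
  Fires R = ∀ {M N} → R M N → M ═[ nτ ]⇒ N

  Resolves : (Net → Net → Set) → Set
  Resolves R = ∀ {M N M′ l} → R M N → M ═[ l ]⇒ M′ →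
    (l ≡ nτ × M′ ≡ N) ⊎ (∃ λ N′ → N ═[ l ]⇒ N′ × R M′ N′)

  SensorClosed : (Net → Net → Set) → Set
  SensorClosed R = ∀ {M N s h v} → R M N → R (updS s h v M) (updS s h v N)

  BarbPreserving : (Net → Net → Set) → Set
  BarbPreserving R = ∀ {M N a v h} → R M N → Barb M a v h → Barb N a v h

  record Administrative (R : Net → Net → Set) : Set where
    field
      fire    : Fires R
      resolve : Resolves R
      sensors : SensorClosed R
      barbs   : BarbPreserving R

  strong⇒weak : ∀ {M M′ α} → M ⟶[ α ] M′ → M ⇒[ α ] M′
  strong⇒weak t = _ , _ , ε , t , ε

  administrative⇒≳ : ∀ {R M N} → Administrative R → R M N → M ≳ N
  administrative⇒≳ {R} adm r = (λ M N → R M N ⊎ M ≡ N) , (expand , contract) , inj₁ r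
    where
      open Administrative adm

      expand : ∀ {M N M′ α} → R M N ⊎ M ≡ N → M ⟶[ α ] M′ →
               ∃ λ N′ → (R M′ N′ ⊎ M′ ≡ N′) × ((N ⟶[ α ] N′) ⊎ (α ≡ eτ × N′ ≡ N))
      expand (inj₂ refl) t = _ , inj₂ refl , inj₁ t
      expand (inj₁ r) (e-τ t) with resolve r t
      ... | inj₁ (_ , refl) = _ , inj₂ refl , inj₂ (refl , refl)
      ... | inj₂ (N′ , t′ , r′) = N′ , inj₁ r′ , inj₁ (e-τ t′)
      expand (inj₁ r) (e-act t) with resolve r t
      ... | inj₁ (() , _)
      ... | inj₂ (N′ , t′ , r′) = N′ , inj₁ r′ , inj₁ (e-act t′)
      expand (inj₁ r) (e-out t d) with resolve r t
      ... | inj₁ (() , _)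
      ... | inj₂ (N′ , t′ , r′) = N′ , inj₁ r′ , inj₁ (e-out t′ d)
      expand (inj₁ r) (e-inp t d) with resolve r t
      ... | inj₁ (() , _)
      ... | inj₂ (N′ , t′ , r′) = N′ , inj₁ r′ , inj₁ (e-inp t′ d)
      expand (inj₁ r) (e-σ σ) = ⊥-elim (maximal-progress σ (_ , fire r))
      expand (inj₁ r) (e-sens d) = _ , inj₁ (sensors r) , inj₁ (e-sens d)
      expand (inj₁ r) (e-barb b) = _ , inj₁ r , inj₁ (e-barb (barbs r b))

      contract : ∀ {M N N′ α} → R M N ⊎ M ≡ N → N ⟶[ α ] N′ →
                 ∃ λ M′ → (M ⇒[ α ] M′) × (R M′ N′ ⊎ M′ ≡ N′)
      contract (inj₂ refl) t = _ , strong⇒weak t , inj₂ refl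
      contract (inj₁ r) t = _ , (_ , _ , e-τ (fire r) ◅ ε , t , ε) , inj₂ refl

  -- Vacuous for process steps that never surface at the node (@h′ with h′ ≢ h, or an action
  -- on an internal channel).
  Absorbed : Iface → Loc → PLab → Proc → Proc → Set
  Absorbed I h pl P′ Q = ∀ {l I′} → Promote I h pl l I′ → l ≡ nτ × I′ ≡ I × P′ ≡ Q

  ProcRel : Set₁
  ProcRel = Iface → Loc → Proc → Proc → Set

  FiresAtNode : ProcRel → Set
  FiresAtNode ℛ = ∀ {I h P Q} → ℛ I h P Q → ∃ λ pl → P ─[ pl ]→ Q × Promote I h pl nτ I

  SplitsAtNode : ProcRel → Set
  SplitsAtNode ℛ = ∀ {I h P Q P′ pl} → ℛ I h P Q → P ─[ pl ]→ P′ →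
    Absorbed I h pl P′ Q ⊎ (∃ λ Q′ → Q ─[ pl ]→ Q′ × ∀ {l I′} → Promote I h pl l I′ → ℛ I′ h P′ Q′)

  record NodeAdministrative (ℛ : ProcRel) : Set where
    field
      fire      : FiresAtNode ℛ
      split     : SplitsAtNode ℛ
      iact-only : ∀ {I I′ h P Q} → iact I′ ≡ iact I → ℛ I h P Q → ℛ I′ h P Q

  data AtNode (ℛ : ProcRel) : Net → Net → Set where
    nodes : ∀ {n I h P Q μ} → ℛ I h P Q → AtNode ℛ (node n I P μ h) (node n I Q μ h)

  nodeAdministrative : ∀ {ℛ} → NodeAdministrative ℛ → Administrative (AtNode ℛ)
  nodeAdministrative {ℛ} adm =
    record { fire = fire′ ; resolve = resolve ; sensors = sensors ; barbs = barbs }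
    where
      open NodeAdministrative adm

      fire′ : Fires (AtNode ℛ)
      fire′ (nodes r) with fire r
      ... | _ , s , pr = node-step pr s

      resolve : Resolves (AtNode ℛ)
      resolve (nodes r) t with node-inv t
      ... | step s pr with split r s
      ...   | inj₁ absorbed with absorbed pr
      ...     | refl , refl , refl = inj₁ (refl , refl)
      resolve (nodes r) t | step s pr | inj₂ (_ , s′ , r′) =
        inj₂ (_ , node-step pr s′ , nodes (r′ pr))

      sensors : SensorClosed (AtNode ℛ)
      sensors {s = s} {h} {v} (nodes {n} {I} {k} {P} {Q} {μ} r)
        rewrite updS-node s h v n I P μ k | updS-node s h v n I Q μ k =
        nodes (iact-only (iact-sensorUpdate s h v I k) r)

      barbs : BarbPreserving (AtNode ℛ)
      barbs (nodes r) b with node-barb⁻ b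
      ... | Ia≡v , refl = node-barb Ia≡v

  node-≳ : ∀ {ℛ n I h P Q μ} → NodeAdministrative ℛ → ℛ I h P Q →
           node n I P μ h ≳ node n I Q μ h
  node-≳ adm r = administrative⇒≳ (nodeAdministrative adm) (nodes r)

  iact-promote : ∀ {I h pl l I′ a} → Promote I h pl l I′ → (∀ {w} → pl ≢ lwr a w) →
                 iact I′ a ≡ iact I a
  iact-promote at-τ _ = refl
  iact-promote (rd-τ _) _ = refl
  iact-promote (wr-τ _) _ = refl
  iact-promote {a = a} (wr-act {a′} _) pl≢ with a′ ≟A a
  ... | yes refl = ⊥-elim (pl≢ refl)
  ... | no _ = refl
  iact-promote τ-τ _ = refl
  iact-promote (out _) _ = refl
  iact-promote (inp _) _ = refl

  data RedundantWrite : ProcRel where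
    redundant : ∀ {I h a v P R} → iact I a ≡ just v → ¬ ActOcc a R →
                RedundantWrite I h (wr a (val v) P ∥ R) (P ∥ R)

  redundantWrite-administrative : NodeAdministrative RedundantWrite
  redundantWrite-administrative = record { fire = fire ; split = split ; iact-only = iact-only }
    where
      fire : FiresAtNode RedundantWrite
      fire (redundant Ia≡v _) = _ , p-parL p-wr , wr-τ Ia≡v

      split : SplitsAtNode RedundantWrite
      split (redundant Ia≡v _) (p-parL p-wr) =
        inj₁ λ { (wr-τ _) → refl , refl , refl ; (wr-act Ia≢v) → ⊥-elim (Ia≢v Ia≡v) }
      split (redundant Ia≡v a∉R) (p-parR s) =
        inj₂ (_ , p-parR s , λ pr →
          redundant (trans (iact-promote pr λ { refl → a∉R (wr-occurs s) }) Ia≡v)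
                    (a∉R ∘ ActOcc-⊑ (step-⊑ s)))
      split (redundant _ _) (p-comL () _ _)
      split (redundant _ _) (p-comR _ () _)

      iact-only : ∀ {I I′ h P Q} → iact I′ ≡ iact I →
                  RedundantWrite I h P Q → RedundantWrite I′ h P Q
      iact-only same-act (redundant {a = a} Ia≡v a∉R) = redundant (trans (cong-app same-act a) Ia≡v) a∉R

  data LocationQuery : ProcRel where
    query : ∀ {I h x P R} → LocationQuery I h (at x P ∥ R) (substV P (locV h) x ∥ R)

  locationQuery-administrative : NodeAdministrative LocationQuery
  locationQuery-administrative = record { fire = fire ; split = split ; iact-only = λ _ → iact-only }
    where
      fire : FiresAtNode LocationQuery
      fire {h = h} query = _ , p-parL (p-at h) , at-τ

      split : SplitsAtNode LocationQuery
      split query (p-parL (p-at _)) = inj₁ λ { at-τ → refl , refl , refl }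
      split query (p-parR s) = inj₂ (_ , p-parR s , λ _ → query)
      split query (p-comL () _ _)
      split query (p-comR _ () _)

      iact-only : ∀ {I I′ h P Q} → LocationQuery I h P Q → LocationQuery I′ h P Q
      iact-only query = query

  data InternalComm : ProcRel where
    internal : ∀ {I h c v x P S′ Q T R} → ¬ ChanOcc c R → rng c ≡ neg1 →
               InternalComm I h (tout c (val v) P S′ ∥ tin c x Q T ∥ R) (P ∥ substV Q v x ∥ R)

  internalComm-administrative : NodeAdministrative InternalComm
  internalComm-administrative = record { fire = fire ; split = split ; iact-only = λ _ → iact-only }
    where
      fire : FiresAtNode InternalComm
      fire (internal {v = v} _ c-internal) = _ , p-comL p-out (p-parL (p-inp v)) c-internal , τ-τ

      split : SplitsAtNode InternalComm
      split (internal _ _) (p-comL p-out (p-parL (p-inp _)) _) = inj₁ λ { τ-τ → refl , refl , refl }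
      split (internal c∉R _) (p-comL p-out (p-parR s) _) = ⊥-elim (c∉R (inp-occurs s))
      split (internal _ _) (p-comR _ () _)
      split (internal _ c-internal) (p-parL p-out) =
        inj₁ λ { (out c≥0) → ⊥-elim (subst NonNeg c-internal c≥0) }
      split (internal _ c-internal) (p-parR (p-parL (p-inp _))) =
        inj₁ λ { (inp c≥0) → ⊥-elim (subst NonNeg c-internal c≥0) }
      split (internal c∉R c-internal) (p-parR (p-parR s)) =
        inj₂ (_ , p-parR (p-parR s) , λ _ → internal (c∉R ∘ ChanOcc-⊑ (step-⊑ s)) c-internal)
      split (internal _ _) (p-parR (p-comL () _ _))
      split (internal c∉R _) (p-parR (p-comR s (p-inp _) _)) = ⊥-elim (c∉R (out-occurs s))

      iact-only : ∀ {I I′ h P Q} → InternalComm I h P Q → InternalComm I′ h P Q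
      iact-only (internal c∉R c-internal) = internal c∉R c-internal

  promote-NotOn : ∀ {I h pl l I′ c R R′} → ¬ ChanOcc c R → Promote I h pl l I′ → R ─[ pl ]→ R′ →
                  NotOn c l
  promote-NotOn c∉R (out _) s refl = c∉R (out-occurs s)
  promote-NotOn c∉R (inp _) s refl = c∉R (inp-occurs s)
  promote-NotOn _ at-τ _ = tt
  promote-NotOn _ (rd-τ _) _ = tt
  promote-NotOn _ (wr-τ _) _ = tt
  promote-NotOn _ (wr-act _) _ = tt
  promote-NotOn _ τ-τ _ = tt

  sender-step : ∀ {n I c v P S′ R μ h l A′} → ¬ ChanOcc c R →
    node n I (tout c (val v) P S′ ∥ R) μ h ═[ l ]⇒ A′ →
    (l ≡ nout c v h × A′ ≡ node n I (P ∥ R) μ h) ⊎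
    (∃₂ λ R′ I′ → A′ ≡ node n I′ (tout c (val v) P S′ ∥ R′) μ h ×
       node n I (P ∥ R) μ h ═[ l ]⇒ node n I′ (P ∥ R′) μ h × ¬ ChanOcc c R′ × NotOn c l)
  sender-step c∉R t with node-inv t
  ... | step (p-parL p-out) (out _) = inj₁ (refl , refl)
  ... | step (p-parR s) pr =
        inj₂ (_ , _ , refl , node-step pr (p-parR s) , c∉R ∘ ChanOcc-⊑ (step-⊑ s) ,
              promote-NotOn c∉R pr s)
  ... | step (p-comL p-out s _) _ = ⊥-elim (c∉R (inp-occurs s))
  ... | step (p-comR _ () _) _

  receiver-step : ∀ {m J c x Q T U μ k l B′} → ¬ ChanOcc c U →
    node m J (tin c x Q T ∥ U) μ k ═[ l ]⇒ B′ →
    (∃ λ w → l ≡ ninp c w k × B′ ≡ node m J (substV Q w x ∥ U) μ k) ⊎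
    (∃₂ λ U′ J′ → B′ ≡ node m J′ (tin c x Q T ∥ U′) μ k ×
       (∀ {w} → node m J (substV Q w x ∥ U) μ k ═[ l ]⇒ node m J′ (substV Q w x ∥ U′) μ k) ×
       ¬ ChanOcc c U′ × NotOn c l)
  receiver-step c∉U t with node-inv t
  ... | step (p-parL (p-inp w)) (inp _) = inj₁ (w , refl , refl)
  ... | step (p-parR s) pr =
        inj₂ (_ , _ , refl , node-step pr (p-parR s) , c∉U ∘ ChanOcc-⊑ (step-⊑ s) ,
              promote-NotOn c∉U pr s)
  ... | step (p-comL () _ _) _
  ... | step (p-comR s (p-inp _) _) _ = ⊥-elim (c∉U (out-occurs s))

  data GlobalComm : Net → Net → Set where
    global : ∀ {n m I J c v x P S′ Q T R U μ μ′ h k} →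
      rng c ≡ inf → ¬ ChanOcc c R → ¬ ChanOcc c U →
      GlobalComm (ν c (node n I (tout c (val v) P S′ ∥ R) μ h ∣ node m J (tin c x Q T ∥ U) μ′ k))
                 (ν c (node n I (P ∥ R) μ h ∣ node m J (substV Q v x ∥ U) μ′ k))

  globalComm-resolve : ∀ {n m I J c v x P S′ Q T R U μ μ′ h k l M′} →
    rng c ≡ inf → ¬ ChanOcc c R → ¬ ChanOcc c U → NotOn c l →
    (node n I (tout c (val v) P S′ ∥ R) μ h ∣ node m J (tin c x Q T ∥ U) μ′ k) ═[ l ]⇒ M′ →
    (l ≡ nτ × M′ ≡ (node n I (P ∥ R) μ h ∣ node m J (substV Q v x ∥ U) μ′ k)) ⊎
    (∃ λ N′ → (node n I (P ∥ R) μ h ∣ node m J (substV Q v x ∥ U) μ′ k) ═[ l ]⇒ N′ ×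
       GlobalComm (ν c M′) (ν c N′))
  globalComm-resolve c-global c∉R c∉U _ (n-comL tA tB d)
    with sender-step c∉R tA | receiver-step c∉U tB
  ... | inj₁ (refl , refl) | inj₁ (_ , refl , refl) = inj₁ (refl , refl)
  ... | inj₁ (refl , refl) | inj₂ (_ , _ , _ , _ , _ , c≢c) = ⊥-elim (c≢c refl)
  ... | inj₂ (_ , _ , _ , _ , _ , c≢c) | inj₁ (_ , refl , refl) = ⊥-elim (c≢c refl)
  ... | inj₂ (_ , _ , refl , tA′ , c∉R′ , _) | inj₂ (_ , _ , refl , tB′ , c∉U′ , _) =
        inj₂ (_ , n-comL tA′ tB′ d , global c-global c∉R′ c∉U′)
  globalComm-resolve c-global c∉R c∉U _ (n-comR tB tA d)
    with sender-step c∉R tA | receiver-step c∉U tB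
  ... | inj₁ (() , _) | _
  ... | inj₂ _ | inj₁ (_ , () , _)
  ... | inj₂ (_ , _ , refl , tA′ , c∉R′ , _) | inj₂ (_ , _ , refl , tB′ , c∉U′ , _) =
        inj₂ (_ , n-comR tB′ tA′ d , global c-global c∉R′ c∉U′)
  globalComm-resolve c-global c∉R c∉U c-free (n-parL tA) with sender-step c∉R tA
  ... | inj₁ (refl , _) = ⊥-elim (c-free refl)
  ... | inj₂ (_ , _ , refl , tA′ , c∉R′ , _) = inj₂ (_ , n-parL tA′ , global c-global c∉R′ c∉U)
  globalComm-resolve c-global c∉R c∉U c-free (n-parR tB) with receiver-step c∉U tB
  ... | inj₁ (_ , refl , _) = ⊥-elim (c-free refl)
  ... | inj₂ (_ , _ , refl , tB′ , c∉U′ , _) = inj₂ (_ , n-parR tB′ , global c-global c∉R c∉U′)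

  globalComm-administrative : Administrative GlobalComm
  globalComm-administrative =
    record { fire = fire ; resolve = resolve ; sensors = sensors ; barbs = barbs }
    where
      fire : Fires GlobalComm
      fire (global {v = v} {h = h} {k = k} c-global _ _) =
        n-res (n-comL (n-out (p-parL p-out) c≥0) (n-inp (p-parL (p-inp v)) c≥0)
                      (subst (d k h ≤ʳ_) (sym c-global) tt)) tt
        where c≥0 = subst NonNeg (sym c-global) tt

      resolve : Resolves GlobalComm
      resolve (global c-global c∉R c∉U) (n-res t c-free)
        with globalComm-resolve c-global c∉R c∉U c-free t
      ... | inj₁ (refl , refl) = inj₁ (refl , refl)
      ... | inj₂ (_ , t′ , r′) = inj₂ (_ , n-res t′ c-free , r′)

      sensors : SensorClosed GlobalComm
      sensors {s = s} {l} {w}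
              (global {n} {m} {I} {J} {c} {v} {x} {P} {S′} {Q} {T} {R} {U} {μ} {μ′} {h} {k} c-global c∉R c∉U)
        rewrite updS-node s l w n I (tout c (val v) P S′ ∥ R) μ h
              | updS-node s l w m J (tin c x Q T ∥ U) μ′ k
              | updS-node s l w n I (P ∥ R) μ h | updS-node s l w m J (substV Q v x ∥ U) μ′ k =
        global c-global c∉R c∉U

      barbs : BarbPreserving GlobalComm
      barbs (global {n} {m} {I} {J} {c} {v} {x} {P} {S′} {Q} {T} {R} {U} {μ} {μ′} {h} {k} _ _ _) b
        with barb⇒sites b
      ... | here (Ia≡v , refl) =
            c ∷ [] , n , I , P ∥ R , μ , node m J (substV Q v x ∥ U) μ′ k , ≡-refl , Ia≡v
      ... | there (here (Ja≡v , refl)) =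
            c ∷ [] , m , J , substV Q v x ∥ U , μ′ , node n I (P ∥ R) μ h , ≡-res ∣-comm , Ja≡v

  -- Bisimulations for empty and relocated nodes

  Simulates : (Net → Net → Set) → Set
  Simulates R = ∀ {M N M′ α} → R M N → M ⟶[ α ] M′ → ∃ λ N′ → (N ⇒̂[ α ] N′) × R M′ N′

  simulations⇒≈ : ∀ {R M N} → Simulates R → Simulates (flip R) → R M N → M ≈ N
  simulations⇒≈ {R} forth back r = (λ M N → R M N ⊎ R N M) , (Sum.swap , sim) , inj₁ r
    where
      sim : Simulates (λ M N → R M N ⊎ R N M)
      sim (inj₁ r) t with forth r t
      ... | N′ , w , r′ = N′ , w , inj₁ r′
      sim (inj₂ r) t with back r t
      ... | N′ , w , r′ = N′ , w , inj₂ r′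

  d-refl-≤δ : ∀ h → d h h ≤ δ
  d-refl-≤δ h = subst (_≤ δ) (sym (d-refl h)) z≤n

  nil-node-inert : ∀ {n I μ h l N} → ¬ (node n I nil μ h ═[ l ]⇒ N)
  nil-node-inert t with node-inv t
  ... | step () _

  nil-node-idles : ∀ {n I μ h} → node n I nil μ h ═σ⇒ node n I nil μ h
  nil-node-idles {μ = stat} = s-stat t-nil (nil-node-inert ∘ proj₂)
  nil-node-idles {μ = mob} {h = h} = s-mob t-nil (nil-node-inert ∘ proj₂) (d-refl-≤δ h)

  data Unplugged : Net → Net → Set where
    unplugged : ∀ {n I μ h} → (∀ a → iact I a ≡ nothing) → Unplugged (node n I nil μ h) 𝟎

  unplugged-≈ : ∀ {M N} → Unplugged M N → M ≈ N
  unplugged-≈ = simulations⇒≈ forth back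
    where
      unplugged-update : ∀ {n I μ h} s k v → (∀ a → iact I a ≡ nothing) →
                         Unplugged (updS s k v (node n I nil μ h)) 𝟎
      unplugged-update {n} {I} {μ} {h} s k v no-act rewrite updS-node s k v n I nil μ h =
        unplugged (λ a → trans (cong-app (iact-sensorUpdate s k v I h) a) (no-act a))

      forth : Simulates Unplugged
      forth (unplugged _) (e-τ t) = ⊥-elim (nil-node-inert t)
      forth (unplugged _) (e-act t) = ⊥-elim (nil-node-inert t)
      forth (unplugged _) (e-out t _) = ⊥-elim (nil-node-inert t)
      forth (unplugged _) (e-inp t _) = ⊥-elim (nil-node-inert t)
      forth (unplugged no-act) (e-σ (s-stat t-nil _)) = 𝟎 , strong⇒weak (e-σ s-zero) , unplugged no-act
      forth (unplugged no-act) (e-σ (s-mob t-nil _ _)) = 𝟎 , strong⇒weak (e-σ s-zero) , unplugged no-act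
      forth (unplugged no-act) (e-sens {s = s} {v} {k} d) =
        𝟎 , strong⇒weak (e-sens d) , unplugged-update s k v no-act
      forth (unplugged no-act) (e-barb {a = a} b) with trans (sym (no-act a)) (proj₁ (node-barb⁻ b))
      ... | ()

      back : Simulates (flip Unplugged)
      back (unplugged no-act) (e-σ s-zero) = _ , strong⇒weak (e-σ nil-node-idles) , unplugged no-act
      back (unplugged no-act) (e-sens {s = s} {v} {k} d) =
        _ , strong⇒weak (e-sens d) , unplugged-update s k v no-act
      back (unplugged _) (e-barb b) with barb⇒sites b
      ... | ()

  record Placeless (P : Proc) : Set where
    field
      no-at       : ¬ HasAt P
      no-actuator : ∀ a → ¬ ActOcc a P
      unbounded   : ∀ c → ChanOcc c P → rng c ≡ inf ⊎ rng c ≡ neg1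
  open Placeless

  placeless-⊑ : ∀ {P P′} → P′ ⊑ P → Placeless P → Placeless P′
  placeless-⊑ le pl = record
    { no-at = no-at pl ∘ HasAt-⊑ le
    ; no-actuator = λ a → no-actuator pl a ∘ ActOcc-⊑ le
    ; unbounded = λ c → unbounded pl c ∘ ChanOcc-⊑ le
    }

  data Relocated : Net → Net → Set where
    relocated : ∀ {n m P μ μ′ h k} → Placeless P → Relocated (node n ∅I P μ h) (node m ∅I P μ′ k)

  placeless-τ : ∀ {n P μ h N} → Placeless P → node n ∅I P μ h ═[ nτ ]⇒ N →
                ∃ λ P′ → P ─[ lτ ]→ P′ × N ≡ node n ∅I P′ μ h
  placeless-τ pl t with node-inv t
  ... | step s at-τ = ⊥-elim (no-at pl (at-occurs s))
  ... | step s τ-τ = _ , s , refl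

  relocated-≈ : ∀ {M N} → Relocated M N → M ≈ N
  relocated-≈ = simulations⇒≈ forth (λ r t → Product.map₂ (Product.map₂ swap) (forth (swap r) t))
    where
      swap : ∀ {M N} → Relocated M N → Relocated N M
      swap (relocated pl) = relocated pl

      τ-elsewhere : ∀ {n m P μ μ′ h k} → Placeless P → ¬ (∃ λ N → node n ∅I P μ h ═[ nτ ]⇒ N) →
                    ¬ (∃ λ N → node m ∅I P μ′ k ═[ nτ ]⇒ N)
      τ-elsewhere pl noτ (_ , t) with placeless-τ pl t
      ... | _ , s , refl = noτ (_ , n-τ s)

      idle-elsewhere : ∀ {n m P P′ μ μ′ h k} → Placeless P → P ─σ→ P′ →
                       ¬ (∃ λ N → node n ∅I P μ h ═[ nτ ]⇒ N) → node m ∅I P μ′ k ═σ⇒ node m ∅I P′ μ′ k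
      idle-elsewhere {μ′ = stat} pl σ noτ = s-stat σ (τ-elsewhere pl noτ)
      idle-elsewhere {μ′ = mob} {k = k} pl σ noτ = s-mob σ (τ-elsewhere pl noτ) (d-refl-≤δ k)

      forth : Simulates Relocated
      forth (relocated pl) (e-τ t) with placeless-τ pl t
      ... | _ , s , refl = _ , e-τ (n-τ s) ◅ ε , relocated (placeless-⊑ (step-⊑ s) pl)
      forth (relocated pl) (e-act t) with node-inv t
      ... | step s (wr-act _) = ⊥-elim (no-actuator pl _ (wr-occurs s))
      forth (relocated pl) (e-out t _) with node-inv t
      ... | step s (out c≥0) with unbounded pl _ (out-occurs s)
      ...   | inj₁ c-global =
              _ , strong⇒weak (e-out (n-out s c≥0) (subst (_ ≤ʳ_) (sym c-global) tt)) ,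
              relocated (placeless-⊑ (step-⊑ s) pl)
      ...   | inj₂ c-internal = ⊥-elim (subst NonNeg c-internal c≥0)
      forth (relocated pl) (e-inp t _) with node-inv t
      ... | step s (inp c≥0) with unbounded pl _ (inp-occurs s)
      ...   | inj₁ c-global =
              _ , strong⇒weak (e-inp (n-inp s c≥0) (subst (_ ≤ʳ_) (sym c-global) tt)) ,
              relocated (placeless-⊑ (step-⊑ s) pl)
      ...   | inj₂ c-internal = ⊥-elim (subst NonNeg c-internal c≥0)
      forth (relocated pl) (e-σ (s-stat σ noτ)) =
        _ , strong⇒weak (e-σ (idle-elsewhere pl σ noτ)) , relocated (placeless-⊑ (σ-⊑ σ) pl)
      forth (relocated pl) (e-σ (s-mob σ noτ _)) =
        _ , strong⇒weak (e-σ (idle-elsewhere pl σ noτ)) , relocated (placeless-⊑ (σ-⊑ σ) pl)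
      forth (relocated {n} {m} {P} {μ} {μ′} {h} {k} pl) (e-sens {s = s} {v} {l} d) =
        _ , strong⇒weak (e-sens d) ,
        subst₂ Relocated (sym (updS-∅I s l v n P μ h)) (sym (updS-∅I s l v m P μ′ k)) (relocated pl)
      forth (relocated pl) (e-barb b) with proj₁ (node-barb⁻ b)
      ... | ()

  -- Free variables and guardedness along transitions

  -- `does (x ≟ z)` normalises to `x ≡ᵇ z`, so `with x ≟ z` cannot abstract it in a goal;
  -- this eliminator recovers the equation or its negation.
  if-≟ : ∀ {ℓ} {A : Set} (C : A → Set ℓ) x z {a b : A} →
         (x ≡ z → C a) → (x ≢ z → C b) → C (if does (x ≟ z) then a else b)
  if-≟ C x z f g with x ≡ᵇ z | ≡ᵇ⇒≡ x z | ≡⇒≡ᵇ x z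
  ... | true  | x≡z | _   = f (x≡z tt)
  ... | false | _   | x≢z = g x≢z

  FVt-subT : ∀ {y x v} t → FVt y (subT x v t) → y ≢ x × FVt y t
  FVt-subT {y} {x} (var z) =
    if-≟ (λ t → FVt y t → y ≢ x × y ≡ z) x z (λ _ ()) (λ x≢z y≡z → (λ { refl → x≢z y≡z }) , y≡z)

  FVts-subT : ∀ {y x v} ts → Any (FVt y) (List.map (subT x v) ts) → y ≢ x × Any (FVt y) ts
  FVts-subT ts o = proj₁ (proj₂ (Any.satisfied a)) , Any.map proj₂ a
    where a = Any.map (FVt-subT _) (map⁻ o)

  mutual
    FV-substV : ∀ {y v x} P → FV y (substV P v x) → y ≢ x × FV y P
    FV-substV (tick P) o = FV-substV P o
    FV-substV (at z P) (y≢z , o) = map₂ (y≢z ,_) (FV-binder P z y≢z o)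
    FV-substV (rd s z P) (y≢z , o) = map₂ (y≢z ,_) (FV-binder P z y≢z o)
    FV-substV (wr a t P) (inj₁ o) = map₂ inj₁ (FVt-subT t o)
    FV-substV (wr a t P) (inj₂ o) = map₂ inj₂ (FV-substV P o)
    FV-substV (P ∥ R) (inj₁ o) = map₂ inj₁ (FV-substV P o)
    FV-substV (P ∥ R) (inj₂ o) = map₂ inj₂ (FV-substV R o)
    FV-substV (tout c t P R) (inj₁ o) = map₂ inj₁ (FVt-subT t o)
    FV-substV (tout c t P R) (inj₂ (inj₁ o)) = map₂ (inj₂ ∘ inj₁) (FV-substV P o)
    FV-substV (tout c t P R) (inj₂ (inj₂ o)) = map₂ (inj₂ ∘ inj₂) (FV-substV R o)
    FV-substV (tin c z P R) (inj₁ (y≢z , o)) = map₂ (inj₁ ∘ (y≢z ,_)) (FV-binder P z y≢z o)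
    FV-substV (tin c z P R) (inj₂ o) = map₂ inj₂ (FV-substV R o)
    FV-substV (cond (gd p ts) P R) (inj₁ o) = map₂ inj₁ (FVts-subT ts o)
    FV-substV (cond (gd p ts) P R) (inj₂ (inj₁ o)) = map₂ (inj₂ ∘ inj₁) (FV-substV P o)
    FV-substV (cond (gd p ts) P R) (inj₂ (inj₂ o)) = map₂ (inj₂ ∘ inj₂) (FV-substV R o)
    FV-substV (fix X P) o = FV-substV P o

    FV-binder : ∀ {y v x} P z → y ≢ z → FV y (if does (x ≟ z) then P else substV P v x) →
                y ≢ x × FV y P
    FV-binder {y} {x = x} P z y≢z =
      if-≟ (λ Q → FV y Q → y ≢ x × FV y P) x z (λ { refl o → y≢z , o }) (λ _ → FV-substV P)

  FV-substP : ∀ {y} P R X → FV y (substP P R X) → FV y P ⊎ FV y R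
  FV-substP (tick P) R X o = FV-substP P R X o
  FV-substP (at z P) R X (y≢z , o) = map₁ (y≢z ,_) (FV-substP P R X o)
  FV-substP (rd s z P) R X (y≢z , o) = map₁ (y≢z ,_) (FV-substP P R X o)
  FV-substP (wr a t P) R X (inj₁ o) = inj₁ (inj₁ o)
  FV-substP (wr a t P) R X (inj₂ o) = map₁ inj₂ (FV-substP P R X o)
  FV-substP (P ∥ P′) R X (inj₁ o) = map₁ inj₁ (FV-substP P R X o)
  FV-substP (P ∥ P′) R X (inj₂ o) = map₁ inj₂ (FV-substP P′ R X o)
  FV-substP (tout c t P P′) R X (inj₁ o) = inj₁ (inj₁ o)
  FV-substP (tout c t P P′) R X (inj₂ (inj₁ o)) = map₁ (inj₂ ∘ inj₁) (FV-substP P R X o)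
  FV-substP (tout c t P P′) R X (inj₂ (inj₂ o)) = map₁ (inj₂ ∘ inj₂) (FV-substP P′ R X o)
  FV-substP (tin c z P P′) R X (inj₁ (y≢z , o)) = map₁ (inj₁ ∘ (y≢z ,_)) (FV-substP P R X o)
  FV-substP (tin c z P P′) R X (inj₂ o) = map₁ inj₂ (FV-substP P′ R X o)
  FV-substP (cond (gd p ts) P P′) R X (inj₁ o) = inj₁ (inj₁ o)
  FV-substP (cond (gd p ts) P P′) R X (inj₂ (inj₁ o)) = map₁ (inj₂ ∘ inj₁) (FV-substP P R X o)
  FV-substP (cond (gd p ts) P P′) R X (inj₂ (inj₂ o)) = map₁ (inj₂ ∘ inj₂) (FV-substP P′ R X o)
  FV-substP (pv Y) R X o with does (X ≟ Y)
  ... | true = inj₂ o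
  FV-substP (fix Y P) R X o with does (X ≟ Y)
  ... | true = inj₁ o
  ... | false = FV-substP P R X o

  FV-unfold : ∀ {y} X P → FV y (substP P (fix X P) X) → FV y (fix X P)
  FV-unfold X P o = [ id , id ] (FV-substP P (fix X P) X o)

  FV-step : ∀ {y P P′ l} → P ─[ l ]→ P′ → FV y P′ → FV y P
  FV-step p-out = inj₂ ∘ inj₁
  FV-step {P = tin c x P _} (p-inp v) = inj₁ ∘ FV-substV P
  FV-step {P = rd s x P} (p-rd v) = FV-substV P
  FV-step p-wr = inj₂
  FV-step {P = at x P} (p-at h) = FV-substV P
  FV-step (p-comL s r _) = Sum.map (FV-step s) (FV-step r)
  FV-step (p-comR s r _) = Sum.map (FV-step r) (FV-step s)
  FV-step (p-parL s) = Sum.map (FV-step s) id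
  FV-step (p-parR s) = Sum.map id (FV-step s)
  FV-step {P = fix X P} (p-fix s) = FV-unfold X P ∘ FV-step s
  FV-step {P = cond (gd _ _) _ _} (p-ifT _ s) = inj₂ ∘ inj₁ ∘ FV-step s
  FV-step {P = cond (gd _ _) _ _} (p-ifF _ s) = inj₂ ∘ inj₂ ∘ FV-step s

  FV-σ : ∀ {y P P′} → P ─σ→ P′ → FV y P′ → FV y P
  FV-σ t-nil = id
  FV-σ t-tick = id
  FV-σ t-tout = inj₂ ∘ inj₂
  FV-σ t-tin = inj₂
  FV-σ (t-par s r _) = Sum.map (FV-σ s) (FV-σ r)
  FV-σ {P = fix X P} (t-fix s) = FV-unfold X P ∘ FV-σ s
  FV-σ {P = cond (gd _ _) _ _} (t-ifT _ s) = inj₂ ∘ inj₁ ∘ FV-σ s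
  FV-σ {P = cond (gd _ _) _ _} (t-ifF _ s) = inj₂ ∘ inj₂ ∘ FV-σ s

  FPV-substV : ∀ {Y} P v x → FPV Y (substV P v x) → FPV Y P
  FPV-substV (tick P) v x = FPV-substV P v x
  FPV-substV (at z P) v x with does (x ≟ z)
  ... | true = id
  ... | false = FPV-substV P v x
  FPV-substV (rd s z P) v x with does (x ≟ z)
  ... | true = id
  ... | false = FPV-substV P v x
  FPV-substV (wr a t P) v x = FPV-substV P v x
  FPV-substV (P ∥ R) v x = Sum.map (FPV-substV P v x) (FPV-substV R v x)
  FPV-substV (tout c t P R) v x = Sum.map (FPV-substV P v x) (FPV-substV R v x)
  FPV-substV (tin c z P R) v x with does (x ≟ z)
  ... | true = Sum.map id (FPV-substV R v x)
  ... | false = Sum.map (FPV-substV P v x) (FPV-substV R v x)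
  FPV-substV (cond b P R) v x = Sum.map (FPV-substV P v x) (FPV-substV R v x)
  FPV-substV (pv Z) v x = id
  FPV-substV (fix Z P) v x = map₂ (FPV-substV P v x)

  FPV-substP : ∀ {Y} P R X → FPV Y (substP P R X) → FPV Y (fix X P) ⊎ FPV Y R
  FPV-substP (tick P) R X o = FPV-substP P R X o
  FPV-substP (at z P) R X o = FPV-substP P R X o
  FPV-substP (rd s z P) R X o = FPV-substP P R X o
  FPV-substP (wr a t P) R X o = FPV-substP P R X o
  FPV-substP (P ∥ P′) R X (inj₁ o) = map₁ (map₂ inj₁) (FPV-substP P R X o)
  FPV-substP (P ∥ P′) R X (inj₂ o) = map₁ (map₂ inj₂) (FPV-substP P′ R X o)
  FPV-substP (tout c t P P′) R X (inj₁ o) = map₁ (map₂ inj₁) (FPV-substP P R X o)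
  FPV-substP (tout c t P P′) R X (inj₂ o) = map₁ (map₂ inj₂) (FPV-substP P′ R X o)
  FPV-substP (tin c z P P′) R X (inj₁ o) = map₁ (map₂ inj₁) (FPV-substP P R X o)
  FPV-substP (tin c z P P′) R X (inj₂ o) = map₁ (map₂ inj₂) (FPV-substP P′ R X o)
  FPV-substP (cond b P P′) R X (inj₁ o) = map₁ (map₂ inj₁) (FPV-substP P R X o)
  FPV-substP (cond b P P′) R X (inj₂ o) = map₁ (map₂ inj₂) (FPV-substP P′ R X o)
  FPV-substP {Y} (pv Z) R X =
    if-≟ (λ Q → FPV Y Q → FPV Y (fix X (pv Z)) ⊎ FPV Y R) X Z
      (λ _ → inj₂) (λ X≢Z Y≡Z → inj₁ ((λ { refl → X≢Z Y≡Z }) , Y≡Z))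
  FPV-substP {Y} (fix Z P) R X (Y≢Z , o) =
    if-≟ (λ Q → FPV Y Q → FPV Y (fix X (fix Z P)) ⊎ FPV Y R) X Z
      (λ { refl o → inj₁ (Y≢Z , Y≢Z , o) })
      (λ _ o → map₁ (map₂ (Y≢Z ,_)) (FPV-substP P R X o)) o

  FPV-unfold : ∀ {Y} X P → FPV Y (substP P (fix X P) X) → FPV Y (fix X P)
  FPV-unfold X P o = [ id , id ] (FPV-substP P (fix X P) X o)

  FPV-step : ∀ {Y P P′ l} → P ─[ l ]→ P′ → FPV Y P′ → FPV Y P
  FPV-step p-out = inj₁
  FPV-step {P = tin c x P _} (p-inp v) = inj₁ ∘ FPV-substV P v x
  FPV-step {P = rd s x P} (p-rd v) = FPV-substV P v x
  FPV-step p-wr = id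
  FPV-step {P = at x P} (p-at h) = FPV-substV P (locV h) x
  FPV-step (p-comL s r _) = Sum.map (FPV-step s) (FPV-step r)
  FPV-step (p-comR s r _) = Sum.map (FPV-step r) (FPV-step s)
  FPV-step (p-parL s) = Sum.map (FPV-step s) id
  FPV-step (p-parR s) = Sum.map id (FPV-step s)
  FPV-step {P = fix X P} (p-fix s) = FPV-unfold X P ∘ FPV-step s
  FPV-step (p-ifT _ s) = inj₁ ∘ FPV-step s
  FPV-step (p-ifF _ s) = inj₂ ∘ FPV-step s

  FPV-σ : ∀ {Y P P′} → P ─σ→ P′ → FPV Y P′ → FPV Y P
  FPV-σ t-nil = id
  FPV-σ t-tick = id
  FPV-σ t-tout = inj₂
  FPV-σ t-tin = inj₂
  FPV-σ (t-par s r _) = Sum.map (FPV-σ s) (FPV-σ r)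
  FPV-σ {P = fix X P} (t-fix s) = FPV-unfold X P ∘ FPV-σ s
  FPV-σ (t-ifT _ s) = inj₁ ∘ FPV-σ s
  FPV-σ (t-ifF _ s) = inj₂ ∘ FPV-σ s

  TGuarded-substV : ∀ {X} P v x → TGuarded X P → TGuarded X (substV P v x)
  TGuarded-substV nil v x = id
  TGuarded-substV (tick P) v x = id
  TGuarded-substV (at z P) v x with does (x ≟ z)
  ... | true = id
  ... | false = TGuarded-substV P v x
  TGuarded-substV (rd s z P) v x with does (x ≟ z)
  ... | true = id
  ... | false = TGuarded-substV P v x
  TGuarded-substV (wr a t P) v x = TGuarded-substV P v x
  TGuarded-substV (P ∥ R) v x = Product.map (TGuarded-substV P v x) (TGuarded-substV R v x)
  TGuarded-substV (tout c t P R) v x = TGuarded-substV P v x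
  TGuarded-substV (tin c z P R) v x with does (x ≟ z)
  ... | true = id
  ... | false = TGuarded-substV P v x
  TGuarded-substV (cond b P R) v x = Product.map (TGuarded-substV P v x) (TGuarded-substV R v x)
  TGuarded-substV (pv Z) v x = id
  TGuarded-substV (fix Z P) v x = Sum.map id (TGuarded-substV P v x)

  FixGuarded-substV : ∀ P v x → FixGuarded P → FixGuarded (substV P v x)
  FixGuarded-substV nil v x = id
  FixGuarded-substV (tick P) v x = FixGuarded-substV P v x
  FixGuarded-substV (at z P) v x with does (x ≟ z)
  ... | true = id
  ... | false = FixGuarded-substV P v x
  FixGuarded-substV (rd s z P) v x with does (x ≟ z)
  ... | true = id
  ... | false = FixGuarded-substV P v x
  FixGuarded-substV (wr a t P) v x = FixGuarded-substV P v x
  FixGuarded-substV (P ∥ R) v x = Product.map (FixGuarded-substV P v x) (FixGuarded-substV R v x)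
  FixGuarded-substV (tout c t P R) v x = Product.map (FixGuarded-substV P v x) (FixGuarded-substV R v x)
  FixGuarded-substV (tin c z P R) v x with does (x ≟ z)
  ... | true = Product.map id (FixGuarded-substV R v x)
  ... | false = Product.map (FixGuarded-substV P v x) (FixGuarded-substV R v x)
  FixGuarded-substV (cond b P R) v x = Product.map (FixGuarded-substV P v x) (FixGuarded-substV R v x)
  FixGuarded-substV (pv Z) v x = id
  FixGuarded-substV (fix Z P) v x = Product.map (TGuarded-substV P v x) (FixGuarded-substV P v x)

  Closedₚ : Proc → Set
  Closedₚ P = ∀ X → ¬ FPV X P

  ¬FPV⇒TGuarded : ∀ Y R → ¬ FPV Y R → TGuarded Y R
  ¬FPV⇒TGuarded Y nil _ = tt
  ¬FPV⇒TGuarded Y (tick R) _ = tt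
  ¬FPV⇒TGuarded Y (at z R) n = ¬FPV⇒TGuarded Y R n
  ¬FPV⇒TGuarded Y (rd s z R) n = ¬FPV⇒TGuarded Y R n
  ¬FPV⇒TGuarded Y (wr a t R) n = ¬FPV⇒TGuarded Y R n
  ¬FPV⇒TGuarded Y (P ∥ R) n = ¬FPV⇒TGuarded Y P (n ∘ inj₁) , ¬FPV⇒TGuarded Y R (n ∘ inj₂)
  ¬FPV⇒TGuarded Y (tout c t P R) n = ¬FPV⇒TGuarded Y P (n ∘ inj₁)
  ¬FPV⇒TGuarded Y (tin c z P R) n = ¬FPV⇒TGuarded Y P (n ∘ inj₁)
  ¬FPV⇒TGuarded Y (cond b P R) n = ¬FPV⇒TGuarded Y P (n ∘ inj₁) , ¬FPV⇒TGuarded Y R (n ∘ inj₂)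
  ¬FPV⇒TGuarded Y (pv Z) n = n
  ¬FPV⇒TGuarded Y (fix Z R) n with Y ≟ Z
  ... | yes Y≡Z = inj₁ Y≡Z
  ... | no Y≢Z = inj₂ (¬FPV⇒TGuarded Y R (n ∘ (Y≢Z ,_)))

  TGuarded-substP : ∀ {Y} P R X → TGuarded Y P → TGuarded Y R → TGuarded Y (substP P R X)
  TGuarded-substP nil R X g _ = g
  TGuarded-substP (tick P) R X g _ = g
  TGuarded-substP (at z P) R X g gR = TGuarded-substP P R X g gR
  TGuarded-substP (rd s z P) R X g gR = TGuarded-substP P R X g gR
  TGuarded-substP (wr a t P) R X g gR = TGuarded-substP P R X g gR
  TGuarded-substP (P ∥ P′) R X (g , g′) gR =
    TGuarded-substP P R X g gR , TGuarded-substP P′ R X g′ gR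
  TGuarded-substP (tout c t P P′) R X g gR = TGuarded-substP P R X g gR
  TGuarded-substP (tin c z P P′) R X g gR = TGuarded-substP P R X g gR
  TGuarded-substP (cond b P P′) R X (g , g′) gR =
    TGuarded-substP P R X g gR , TGuarded-substP P′ R X g′ gR
  TGuarded-substP (pv Z) R X g gR with does (X ≟ Z)
  ... | true = gR
  ... | false = g
  TGuarded-substP (fix Z P) R X g gR with does (X ≟ Z)
  ... | true = g
  ... | false = Sum.map id (λ g → TGuarded-substP P R X g gR) g

  FixGuarded-substP : ∀ P R X → FixGuarded P → FixGuarded R → Closedₚ R → FixGuarded (substP P R X)
  FixGuarded-substP nil R X g _ _ = g
  FixGuarded-substP (tick P) R X g gR cR = FixGuarded-substP P R X g gR cR
  FixGuarded-substP (at z P) R X g gR cR = FixGuarded-substP P R X g gR cR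
  FixGuarded-substP (rd s z P) R X g gR cR = FixGuarded-substP P R X g gR cR
  FixGuarded-substP (wr a t P) R X g gR cR = FixGuarded-substP P R X g gR cR
  FixGuarded-substP (P ∥ P′) R X (g , g′) gR cR =
    FixGuarded-substP P R X g gR cR , FixGuarded-substP P′ R X g′ gR cR
  FixGuarded-substP (tout c t P P′) R X (g , g′) gR cR =
    FixGuarded-substP P R X g gR cR , FixGuarded-substP P′ R X g′ gR cR
  FixGuarded-substP (tin c z P P′) R X (g , g′) gR cR =
    FixGuarded-substP P R X g gR cR , FixGuarded-substP P′ R X g′ gR cR
  FixGuarded-substP (cond b P P′) R X (g , g′) gR cR =
    FixGuarded-substP P R X g gR cR , FixGuarded-substP P′ R X g′ gR cR
  FixGuarded-substP (pv Z) R X g gR cR with does (X ≟ Z)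
  ... | true = gR
  ... | false = g
  FixGuarded-substP (fix Z P) R X g gR cR with does (X ≟ Z)
  ... | true = g
  ... | false = TGuarded-substP P R X (proj₁ g) (¬FPV⇒TGuarded Z R (cR Z)) ,
                FixGuarded-substP P R X (proj₂ g) gR cR

  FixGuarded-unfold : ∀ X P → FixGuarded (fix X P) → Closedₚ (fix X P) →
                      FixGuarded (substP P (fix X P) X)
  FixGuarded-unfold X P g@(_ , gP) = FixGuarded-substP P (fix X P) X gP g

  FixGuarded-step : ∀ {P P′ l} → P ─[ l ]→ P′ → FixGuarded P → Closedₚ P → FixGuarded P′
  FixGuarded-step p-out (g , _) _ = g
  FixGuarded-step {tin c x P _} (p-inp v) (g , _) _ = FixGuarded-substV P v x g
  FixGuarded-step {rd s x P} (p-rd v) g _ = FixGuarded-substV P v x g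
  FixGuarded-step p-wr g _ = g
  FixGuarded-step {at x P} (p-at h) g _ = FixGuarded-substV P (locV h) x g
  FixGuarded-step (p-comL s r _) (g , g′) cl =
    FixGuarded-step s g (λ Y → cl Y ∘ inj₁) , FixGuarded-step r g′ (λ Y → cl Y ∘ inj₂)
  FixGuarded-step (p-comR s r _) (g , g′) cl =
    FixGuarded-step r g (λ Y → cl Y ∘ inj₁) , FixGuarded-step s g′ (λ Y → cl Y ∘ inj₂)
  FixGuarded-step (p-parL s) (g , g′) cl = FixGuarded-step s g (λ Y → cl Y ∘ inj₁) , g′
  FixGuarded-step (p-parR s) (g , g′) cl = g , FixGuarded-step s g′ (λ Y → cl Y ∘ inj₂)
  FixGuarded-step {fix X P} (p-fix s) g cl =
    FixGuarded-step s (FixGuarded-unfold X P g cl) (λ Y → cl Y ∘ FPV-unfold X P)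
  FixGuarded-step (p-ifT _ s) (g , _) cl = FixGuarded-step s g (λ Y → cl Y ∘ inj₁)
  FixGuarded-step (p-ifF _ s) (_ , g) cl = FixGuarded-step s g (λ Y → cl Y ∘ inj₂)

  FixGuarded-σ : ∀ {P P′} → P ─σ→ P′ → FixGuarded P → Closedₚ P → FixGuarded P′
  FixGuarded-σ t-nil g _ = g
  FixGuarded-σ t-tick g _ = g
  FixGuarded-σ t-tout (_ , g) _ = g
  FixGuarded-σ t-tin (_ , g) _ = g
  FixGuarded-σ (t-par s r _) (g , g′) cl =
    FixGuarded-σ s g (λ Y → cl Y ∘ inj₁) , FixGuarded-σ r g′ (λ Y → cl Y ∘ inj₂)
  FixGuarded-σ {fix X P} (t-fix s) g cl =
    FixGuarded-σ s (FixGuarded-unfold X P g cl) (λ Y → cl Y ∘ FPV-unfold X P)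
  FixGuarded-σ (t-ifT _ s) (g , _) cl = FixGuarded-σ s g (λ Y → cl Y ∘ inj₁)
  FixGuarded-σ (t-ifF _ s) (_ , g) cl = FixGuarded-σ s g (λ Y → cl Y ∘ inj₂)

  -- The size of P above its time guards.  Steps of an inert process and unfoldings of guarded
  -- recursion strictly decrease it, which bounds the τ-steps before time can pass.
  untimedSize : Proc → ℕ
  untimedSize (at x P) = suc (untimedSize P)
  untimedSize (rd s x P) = suc (untimedSize P)
  untimedSize (wr a t P) = suc (untimedSize P)
  untimedSize (P ∥ Q) = suc (untimedSize P + untimedSize Q)
  untimedSize (cond b P Q) = suc (untimedSize P + untimedSize Q)
  untimedSize (fix X P) = suc (untimedSize P)
  untimedSize _ = 0

  untimedSize-substV : ∀ P v x → untimedSize (substV P v x) ≡ untimedSize P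
  untimedSize-substV (at z P) v x with does (x ≟ z)
  ... | true = refl
  ... | false = cong suc (untimedSize-substV P v x)
  untimedSize-substV (rd s z P) v x with does (x ≟ z)
  ... | true = refl
  ... | false = cong suc (untimedSize-substV P v x)
  untimedSize-substV (wr a t P) v x = cong suc (untimedSize-substV P v x)
  untimedSize-substV (P ∥ Q) v x =
    cong suc (cong₂ _+_ (untimedSize-substV P v x) (untimedSize-substV Q v x))
  untimedSize-substV (cond b P Q) v x =
    cong suc (cong₂ _+_ (untimedSize-substV P v x) (untimedSize-substV Q v x))
  untimedSize-substV (fix X P) v x = cong suc (untimedSize-substV P v x)
  untimedSize-substV nil v x = refl
  untimedSize-substV (tick P) v x = refl
  untimedSize-substV (tout c t P Q) v x = refl
  untimedSize-substV (tin c z P Q) v x = refl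
  untimedSize-substV (pv X) v x = refl

  untimedSize-substP : ∀ P R X → TGuarded X P → untimedSize (substP P R X) ≡ untimedSize P
  untimedSize-substP (at z P) R X g = cong suc (untimedSize-substP P R X g)
  untimedSize-substP (rd s z P) R X g = cong suc (untimedSize-substP P R X g)
  untimedSize-substP (wr a t P) R X g = cong suc (untimedSize-substP P R X g)
  untimedSize-substP (P ∥ Q) R X (g , g′) =
    cong suc (cong₂ _+_ (untimedSize-substP P R X g) (untimedSize-substP Q R X g′))
  untimedSize-substP (cond b P Q) R X (g , g′) =
    cong suc (cong₂ _+_ (untimedSize-substP P R X g) (untimedSize-substP Q R X g′))
  untimedSize-substP nil R X g = refl
  untimedSize-substP (tick P) R X g = refl
  untimedSize-substP (tout c t P Q) R X g = refl
  untimedSize-substP (tin c z P Q) R X g = refl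
  untimedSize-substP (pv Z) R X X≢Z =
    if-≟ (λ Q → untimedSize Q ≡ 0) X Z (λ X≡Z → ⊥-elim (X≢Z X≡Z)) (λ _ → refl)
  untimedSize-substP (fix Z P) R X g =
    if-≟ (λ Q → suc (untimedSize Q) ≡ suc (untimedSize P)) X Z (λ _ → refl)
      (λ X≢Z → cong suc (untimedSize-substP P R X ([ (λ X≡Z → ⊥-elim (X≢Z X≡Z)) , id ] g)))

  -- Inert processes

  record Inert (P : Proc) : Set where
    field
      passive : ¬ HasPrefixOrAct P
      closedᵥ : ∀ x → ¬ FV x P
      closedₚ : Closedₚ P
      guarded : FixGuarded P
  open Inert

  inert-step : ∀ {P P′ l} → P ─[ l ]→ P′ → Inert P → Inert P′
  inert-step s i = record
    { passive = passive i ∘ HasPrefixOrAct-⊑ (step-⊑ s)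
    ; closedᵥ = λ x → closedᵥ i x ∘ FV-step s
    ; closedₚ = λ X → closedₚ i X ∘ FPV-step s
    ; guarded = FixGuarded-step s (guarded i) (closedₚ i)
    }

  inert-σ : ∀ {P P′} → P ─σ→ P′ → Inert P → Inert P′
  inert-σ s i = record
    { passive = passive i ∘ HasPrefixOrAct-⊑ (σ-⊑ s)
    ; closedᵥ = λ x → closedᵥ i x ∘ FV-σ s
    ; closedₚ = λ X → closedₚ i X ∘ FPV-σ s
    ; guarded = FixGuarded-σ s (guarded i) (closedₚ i)
    }

  inert-unfold : ∀ {X P} → Inert (fix X P) → Inert (substP P (fix X P) X)
  inert-unfold {X} {P} i = record
    { passive = passive i ∘ HasPrefixOrAct-⊑ (unfold-⊑ X P)
    ; closedᵥ = λ x → closedᵥ i x ∘ FV-unfold X P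
    ; closedₚ = λ Y → closedₚ i Y ∘ FPV-unfold X P
    ; guarded = FixGuarded-unfold X P (guarded i) (closedₚ i)
    }

  inert-∥ : ∀ {P Q} → Inert (P ∥ Q) → Inert P × Inert Q
  inert-∥ i =
    record { passive = passive i ∘ inj₁ ; closedᵥ = λ x → closedᵥ i x ∘ inj₁
           ; closedₚ = λ X → closedₚ i X ∘ inj₁ ; guarded = proj₁ (guarded i) } ,
    record { passive = passive i ∘ inj₂ ; closedᵥ = λ x → closedᵥ i x ∘ inj₂
           ; closedₚ = λ X → closedₚ i X ∘ inj₂ ; guarded = proj₂ (guarded i) }

  inert-cond : ∀ {p ts P Q} → Inert (cond (gd p ts) P Q) → Inert P × Inert Q
  inert-cond i =
    record { passive = passive i ∘ inj₁ ; closedᵥ = λ x → closedᵥ i x ∘ inj₂ ∘ inj₁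
           ; closedₚ = λ X → closedₚ i X ∘ inj₁ ; guarded = proj₁ (guarded i) } ,
    record { passive = passive i ∘ inj₂ ; closedᵥ = λ x → closedᵥ i x ∘ inj₂ ∘ inj₂
           ; closedₚ = λ X → closedₚ i X ∘ inj₂ ; guarded = proj₂ (guarded i) }

  AtOrRead : PLab → Set
  AtOrRead (lat _) = ⊤
  AtOrRead (lrd _ _) = ⊤
  AtOrRead _ = ⊥

  inert-silent : ∀ {P} → Inert P → ¬ Occ ActOrComm P
  inert-silent {P} i = passive i ∘ Occ⇒HasPrefixOrAct P

  inert-label : ∀ {P P′ l} → Inert P → P ─[ l ]→ P′ → AtOrRead l
  inert-label {l = lat _} _ _ = tt
  inert-label {l = lrd _ _} _ _ = tt
  inert-label {P} {l = lτ} i s = inert-silent i (Occ-map (λ { (_ , refl) → tt }) P (emits s))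
  inert-label {P} {l = lout _ _} i s = inert-silent i (Occ-map (λ { refl → tt }) P (emits s))
  inert-label {P} {l = linp _ _} i s = inert-silent i (Occ-map (λ { refl → tt }) P (emits s))
  inert-label {P} {l = lwr _ _} i s = inert-silent i (Occ-map (λ { refl → tt }) P (emits s))

  inert-decreasing : ∀ {P P′ l} → Inert P → P ─[ l ]→ P′ → untimedSize P′ < untimedSize P
  inert-decreasing {rd s x P} _ (p-rd v) = s≤s (≤-reflexive (untimedSize-substV P v x))
  inert-decreasing {at x P} _ (p-at h) = s≤s (≤-reflexive (untimedSize-substV P (locV h) x))
  inert-decreasing i p-out = ⊥-elim (passive i tt)
  inert-decreasing i (p-inp _) = ⊥-elim (passive i tt)
  inert-decreasing i p-wr = ⊥-elim (passive i tt)
  inert-decreasing i (p-comL s _ _) = ⊥-elim (inert-label (proj₁ (inert-∥ i)) s)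
  inert-decreasing i (p-comR _ r _) = ⊥-elim (inert-label (proj₁ (inert-∥ i)) r)
  inert-decreasing {P ∥ Q} i (p-parL s) =
    s≤s (+-monoˡ-< (untimedSize Q) (inert-decreasing (proj₁ (inert-∥ i)) s))
  inert-decreasing {Q ∥ P} i (p-parR s) =
    s≤s (+-monoʳ-< (untimedSize Q) (inert-decreasing (proj₂ (inert-∥ i)) s))
  inert-decreasing {fix X P} i (p-fix s) =
    m<n⇒m<1+n (subst (_ <_) (untimedSize-substP P (fix X P) X (proj₁ (guarded i)))
                             (inert-decreasing (inert-unfold i) s))
  inert-decreasing {cond (gd _ _) P Q} i (p-ifT _ s) =
    m<n⇒m<1+n (<-≤-trans (inert-decreasing (proj₁ (inert-cond i)) s) (m≤m+n _ _))
  inert-decreasing {cond (gd _ _) P Q} i (p-ifF _ s) =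
    m<n⇒m<1+n (<-≤-trans (inert-decreasing (proj₂ (inert-cond i)) s) (m≤n+m _ _))

  closedArgs-closed : ∀ ts → (∀ x → ¬ Any (FVt x) ts) → ∃ λ vs → closedArgs ts ≡ just vs
  closedArgs-closed [] _ = [] , refl
  closedArgs-closed (var z ∷ ts) cl = ⊥-elim (cl z (here refl))
  closedArgs-closed (val v ∷ ts) cl with closedArgs ts | closedArgs-closed ts (λ x → cl x ∘ there)
  ... | just vs | _ = v ∷ vs , refl

  evalG-closed : ∀ p ts → (∀ x → ¬ Any (FVt x) ts) → ∃ λ β → evalG (gd p ts) ≡ just β
  evalG-closed p ts cl with closedArgs ts | closedArgs-closed ts cl
  ... | just vs | _ = ⟦ p ⟧ vs , refl

  Stuck : Proc → Set
  Stuck P = ∀ {l P′} → ¬ (P ─[ l ]→ P′)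

  stuck-∥ : ∀ {P Q} → Stuck P → Stuck Q → Stuck (P ∥ Q)
  stuck-∥ stP stQ (p-comL s _ _) = stP s
  stuck-∥ stP stQ (p-comR s _ _) = stQ s
  stuck-∥ stP stQ (p-parL s) = stP s
  stuck-∥ stP stQ (p-parR s) = stQ s

  stuck-ifT : ∀ {b P Q} → evalG b ≡ just true → Stuck P → Stuck (cond b P Q)
  stuck-ifT _ stP (p-ifT _ s) = stP s
  stuck-ifT b-true _ (p-ifF b-false _) with trans (sym b-true) b-false
  ... | ()

  stuck-ifF : ∀ {b P Q} → evalG b ≡ just false → Stuck Q → Stuck (cond b P Q)
  stuck-ifF _ stQ (p-ifF _ s) = stQ s
  stuck-ifF b-false _ (p-ifT b-true _) with trans (sym b-false) b-true
  ... | ()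

  SensorsDefined : Iface → Proc → Set
  SensorsDefined I P = ∀ s → SensOcc s P → Defined (isens I s)

  data Progress (I : Iface) (h : Loc) (P : Proc) : Set where
    moves : ∀ {pl P′} → P ─[ pl ]→ P′ → Promote I h pl nτ I → Progress I h P
    waits : ∀ {P′} → P ─σ→ P′ → Stuck P → Progress I h P

  progress : ∀ {I h} P → Inert P → SensorsDefined I P → Acc _<_ (untimedSize P) → Progress I h P
  progress nil _ _ _ = waits t-nil λ ()
  progress (tick P) _ _ _ = waits t-tick λ ()
  progress {h = h} (at x P) _ _ _ = moves (p-at h) at-τ
  progress (rd s x P) _ sd _ with sd s (inj₁ refl)
  ... | v , Is≡v = moves (p-rd v) (rd-τ Is≡v)
  progress (wr a t P) i _ _ = ⊥-elim (passive i tt)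
  progress (tout c t P Q) i _ _ = ⊥-elim (passive i tt)
  progress (tin c x P Q) i _ _ = ⊥-elim (passive i tt)
  progress (P ∥ Q) i sd (acc rs)
    with progress P (proj₁ (inert-∥ i)) (λ s → sd s ∘ inj₁) (rs (s≤s (m≤m+n _ _)))
  ... | moves s pr = moves (p-parL s) pr
  ... | waits σP stP with progress Q (proj₂ (inert-∥ i)) (λ s → sd s ∘ inj₂) (rs (s≤s (m≤n+m _ _)))
  ...   | moves s pr = moves (p-parR s) pr
  ...   | waits σQ stQ = waits (t-par σP σQ λ (_ , s) → stuck-∥ stP stQ s) (stuck-∥ stP stQ)
  progress (cond (gd p ts) P Q) i sd (acc rs) with evalG-closed p ts (λ x → closedᵥ i x ∘ inj₁)
  ... | true , b-true with progress P (proj₁ (inert-cond i)) (λ s → sd s ∘ inj₁) (rs (s≤s (m≤m+n _ _)))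
  ...   | moves s pr = moves (p-ifT b-true s) pr
  ...   | waits σ st = waits (t-ifT b-true σ) (stuck-ifT b-true st)
  progress (cond (gd p ts) P Q) i sd (acc rs) | false , b-false
    with progress Q (proj₂ (inert-cond i)) (λ s → sd s ∘ inj₂) (rs (s≤s (m≤n+m _ _)))
  ...   | moves s pr = moves (p-ifF b-false s) pr
  ...   | waits σ st = waits (t-ifF b-false σ) (stuck-ifF b-false st)
  progress (pv X) i _ _ = ⊥-elim (closedₚ i X refl)
  progress (fix X P) i sd (acc rs)
    with progress (substP P (fix X P) X) (inert-unfold i) (λ s → sd s ∘ SensOcc-⊑ (unfold-⊑ X P))
           (rs (s≤s (≤-reflexive (untimedSize-substP P (fix X P) X (proj₁ (guarded i))))))
  ... | moves s pr = moves (p-fix s) pr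
  ... | waits σ st = waits (t-fix σ) λ { (p-fix s) → st s }

  settle : ∀ {n I μ h} P → Inert P → SensorsDefined I P → Acc _<_ (untimedSize P) →
           Σ[ P′ ∈ Proc ] Σ[ P″ ∈ Proc ]
             (node n I P μ h ⇒ node n I P′ μ h) × P′ ─σ→ P″ × Stuck P′ × Inert P′ × SensorsDefined I P′
  settle P i sd (acc rs) with progress P i sd (<-wellFounded (untimedSize P))
  ... | waits σ st = P , _ , ε , σ , st , i , sd
  ... | moves s pr
    with settle _ (inert-step s i) (λ s′ → sd s′ ∘ SensOcc-⊑ (step-⊑ s)) (rs (inert-decreasing i s))
  ...   | P′ , P″ , steps , σ , st , i′ , sd′ =
          P′ , P″ , e-τ (node-step pr s) ◅ steps , σ , st , i′ , sd′

  data Idle : Net → Net → Set where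
    idle : ∀ {n I P μ h} → Inert P → SensorsDefined I P → Idle (node n I P μ h) (node n I nil μ h)

  idle-≈ : ∀ {M N} → Idle M N → M ≈ N
  idle-≈ = simulations⇒≈ forth back
    where
      promote-τ-iface : ∀ {I h pl I′} → Promote I h pl nτ I′ → I′ ≡ I
      promote-τ-iface at-τ = refl
      promote-τ-iface (rd-τ _) = refl
      promote-τ-iface (wr-τ _) = refl
      promote-τ-iface τ-τ = refl

      stuck-node : ∀ {n I P μ h} → Stuck P → ¬ (∃ λ N → node n I P μ h ═[ nτ ]⇒ N)
      stuck-node st (_ , t) with node-inv t
      ... | step s _ = st s

      idle-update : ∀ {n I P μ h} s k v → Inert P → SensorsDefined I P →
                    Idle (updS s k v (node n I P μ h)) (updS s k v (node n I nil μ h))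
      idle-update {n} {I} {P} {μ} {h} s k v i sd
        rewrite updS-node s k v n I P μ h | updS-node s k v n I nil μ h =
        idle i (λ s′ → Defined-sensorUpdate s k v I h s′ ∘ sd s′)

      idle-σ : ∀ {n I P P′ μ h} → P ─σ→ P′ → Inert P → SensorsDefined I P →
               Idle (node n I P′ μ h) (node n I nil μ h)
      idle-σ σ i sd = idle (inert-σ σ i) (λ s → sd s ∘ SensOcc-⊑ (σ-⊑ σ))

      forth : Simulates Idle
      forth (idle i sd) (e-τ t) with node-inv t
      ... | step s pr with promote-τ-iface pr
      ...   | refl = _ , ε , idle (inert-step s i) (λ s′ → sd s′ ∘ SensOcc-⊑ (step-⊑ s))
      forth (idle i _) (e-act t) with node-inv t
      ... | step s (wr-act _) = ⊥-elim (inert-label i s)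
      forth (idle i _) (e-out t _) with node-inv t
      ... | step s (out _) = ⊥-elim (inert-label i s)
      forth (idle i _) (e-inp t _) with node-inv t
      ... | step s (inp _) = ⊥-elim (inert-label i s)
      forth (idle i sd) (e-σ (s-stat σ _)) = _ , strong⇒weak (e-σ nil-node-idles) , idle-σ σ i sd
      forth (idle i sd) (e-σ (s-mob σ _ d)) =
        _ , strong⇒weak (e-σ (s-mob t-nil (nil-node-inert ∘ proj₂) d)) , idle-σ σ i sd
      forth (idle i sd) (e-sens {s = s} {v} {k} d) =
        _ , strong⇒weak (e-sens d) , idle-update s k v i sd
      forth (idle i sd) (e-barb b) with node-barb⁻ b
      ... | Ia≡v , refl = _ , strong⇒weak (e-barb (node-barb Ia≡v)) , idle i sd

      back : Simulates (flip Idle)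
      back (idle _ _) (e-τ t) = ⊥-elim (nil-node-inert t)
      back (idle _ _) (e-act t) = ⊥-elim (nil-node-inert t)
      back (idle _ _) (e-out t _) = ⊥-elim (nil-node-inert t)
      back (idle _ _) (e-inp t _) = ⊥-elim (nil-node-inert t)
      back (idle {P = P} i sd) (e-σ (s-stat t-nil _)) with settle P i sd (<-wellFounded _)
      ... | _ , _ , steps , σ , st , i′ , sd′ =
            _ , (_ , _ , steps , e-σ (s-stat σ (stuck-node st)) , ε) , idle-σ σ i′ sd′
      back (idle {P = P} i sd) (e-σ (s-mob t-nil _ d)) with settle P i sd (<-wellFounded _)
      ... | _ , _ , steps , σ , st , i′ , sd′ =
            _ , (_ , _ , steps , e-σ (s-mob σ (stuck-node st) d) , ε) , idle-σ σ i′ sd′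
      back (idle i sd) (e-sens {s = s} {v} {k} d) =
        _ , strong⇒weak (e-sens d) , idle-update s k v i sd
      back (idle i sd) (e-barb b) with node-barb⁻ b
      ... | Ia≡v , refl = _ , strong⇒weak (e-barb (node-barb Ia≡v)) , idle i sd

  node-ok : ∀ {n I P μ h} → WF (node n I P μ h) → NodeOK (nd n I P μ h)
  node-ok (_ , ok All.∷ _) = ok

  wf-inert : ∀ {n I P μ h} → ¬ HasPrefixOrAct P → WF (node n I P μ h) → Inert P
  wf-inert passive wf = record
    { passive = passive ; closedᵥ = NodeOK.closedV ok ; closedₚ = NodeOK.closedP ok
    ; guarded = NodeOK.guarded ok }
    where ok = node-ok wf

  wf-sensorsDefined : ∀ {n I P μ h} → WF (node n I P μ h) → SensorsDefined I P
  wf-sensorsDefined = NodeOK.sensOK ∘ node-ok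

  wf-placeless : ∀ {n P μ h} → ¬ HasAt P → (∀ c → ChanOcc c P → rng c ≡ inf ⊎ rng c ≡ neg1) →
                 WF (node n ∅I P μ h) → Placeless P
  wf-placeless no-at unbounded wf = record
    { no-at = no-at ; unbounded = unbounded
    ; no-actuator = λ a o → case NodeOK.actOK (node-ok wf) a o of λ { (_ , ()) } }

theorem2 : (S : Setting) → let open Setting S in let open CaIT S in
  (∀ n I a v P R μ h → iact I a ≡ just v → ¬ ActOcc a R →
     WF (node n I (wr a (val v) P ∥ R) μ h) → WF (node n I (P ∥ R) μ h) →
     node n I (wr a (val v) P ∥ R) μ h ≳ node n I (P ∥ R) μ h)
  × (∀ n I x P R μ h →
     WF (node n I (at x P ∥ R) μ h) → WF (node n I (substV P (locV h) x ∥ R) μ h) →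
     node n I (at x P ∥ R) μ h ≳ node n I (substV P (locV h) x ∥ R) μ h)
  × (∀ n I c v x P S' Q T R μ h → ¬ ChanOcc c R → rng c ≡ neg1 →
     WF (node n I (tout c (val v) P S' ∥ tin c x Q T ∥ R) μ h) →
     WF (node n I (P ∥ substV Q v x ∥ R) μ h) →
     node n I (tout c (val v) P S' ∥ tin c x Q T ∥ R) μ h
       ≳ node n I (P ∥ substV Q v x ∥ R) μ h)
  × (∀ n m I J c v x P S' Q T R U μ μ' h k → rng c ≡ inf →
     ¬ ChanOcc c R → ¬ ChanOcc c U →
     WF (ν c (node n I (tout c (val v) P S' ∥ R) μ h ∣ node m J (tin c x Q T ∥ U) μ' k)) →
     WF (ν c (node n I (P ∥ R) μ h ∣ node m J (substV Q v x ∥ U) μ' k)) →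
     ν c (node n I (tout c (val v) P S' ∥ R) μ h ∣ node m J (tin c x Q T ∥ U) μ' k)
       ≳ ν c (node n I (P ∥ R) μ h ∣ node m J (substV Q v x ∥ U) μ' k))
  × (∀ n I P μ h → ¬ HasPrefixOrAct P →
     WF (node n I P μ h) → WF (node n I nil μ h) →
     node n I P μ h ≈ node n I nil μ h)
  × (∀ n I μ h → (∀ a → iact I a ≡ nothing) →
     WF (node n I nil μ h) → WF 𝟎 →
     node n I nil μ h ≈ 𝟎)
  × (∀ n m P h k → ¬ HasAt P →
     (∀ c → ChanOcc c P → rng c ≡ inf ⊎ rng c ≡ neg1) →
     WF (node n ∅I P mob h) → WF (node m ∅I P stat k) →
     node n ∅I P mob h ≈ node m ∅I P stat k)
theorem2 S =
  (λ _ _ _ _ _ _ _ _ Ia≡v a∉R _ _ → node-≳ redundantWrite-administrative (redundant Ia≡v a∉R)) ,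
  (λ _ _ _ _ _ _ _ _ _ → node-≳ locationQuery-administrative query) ,
  (λ _ _ _ _ _ _ _ _ _ _ _ _ c∉R c-internal _ _ →
     node-≳ internalComm-administrative (internal c∉R c-internal)) ,
  (λ _ _ _ _ _ _ _ _ _ _ _ _ _ _ _ _ _ c-global c∉R c∉U _ _ →
     administrative⇒≳ globalComm-administrative (global c-global c∉R c∉U)) ,
  (λ _ _ _ _ _ passive wf _ → idle-≈ (idle (wf-inert passive wf) (wf-sensorsDefined wf))) ,
  (λ _ _ _ _ no-actuator _ _ → unplugged-≈ (unplugged no-actuator)) ,
  (λ _ _ _ _ _ no-at unbounded wf _ → relocated-≈ (relocated (wf-placeless no-at unbounded wf)))
  where open Properties S
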